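{- There exist absolute constants $c_1, c_2 > 0$ such that for all integers $d$ and $k$ with $1 \le k \le c_1\sqrt{d}$, the instance $\Delta[k,d]$ has combinatorial value at least $c_2\, k/d$.
   Context: The $d$-dimensional hypercube $Q_d = (V_d, E_d)$ has vertex set $V_d = \{0,1\}^d$ (coordinates indexed $1,\dots,d$), and two vertices are joined by an edge iff they differ in exactly one coordinate; for an edge $e=\{v_1,v_2\}$ let $i(e)$ be that coordinate. A Max-2-LIN$(\mathbb{Z}_2)$ instance on $Q_d$ is a function $I : E_d \to \{0,1\}$; edges with $I(e)=0$ are equality edges and edges with $I(e)=1$ are inequality edges. An assignment $\sigma : V_d \to \{0,1\}$ satisfies an equality edge $\{u,v\}$ if $\sigma(u)=\sigma(v)$ and an inequality edge if $\sigma(u)\neq\sigma(v)$. The combinatorial value of $I$ is the minimum, over all assignments $\sigma$, of the fraction of edges of $E_d$ not satisfied by $\sigma$. For a vertex $v$ let $H(v[k])$ denote the number of coordinates $j \in \{k+1,\dots,d\}$ with $v_j = 1$. The instance $\Delta[k,d] : E_d \to \{0,1\}$ is defined as follows: for an edge $e = \{v_1,v_2\}$, if $i(e) > k$ then $\Delta[k,d](e)=0$; if $i(e)\le k$ and $H(v_1[k]) > \frac{d-k}{2}$ then $\Delta[k,d](e) = 0$; otherwise $\Delta[k,d](e)=1$. (When $i(e)\le k$, $v_1$ and $v_2$ agree on coordinates $k+1,\dots,d$, so this is well defined.) -}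

module Defs where

open import Data.Bool using (Bool; true; false; not; _xor_; _∧_; if_then_else_)
open import Data.Nat using (ℕ; zero; suc; _+_; _*_; _≤ᵇ_; _<ᵇ_)
open import Data.Fin using (Fin; toℕ)
open import Data.List using (List; []; _∷_; map; concatMap; filterᵇ; length; sum; allFin)
open import Data.Vec using (Vec; []; _∷_; lookup; _[_]%=_)
open import Data.Integer using (+_)
open import Data.Rational using (ℚ; _/_)
open import Relation.Nullary.Decidable using (does)
open import Relation.Binary.PropositionalEquality using (_≡_)
open import Data.Bool.Properties using () renaming (_≟_ to _≟ᵇ_)

-- Vertices of Q_d: Vec Bool d  (true = coordinate value 1).
-- Coordinate i : Fin d corresponds to the paper's coordinate (toℕ i + 1).

allVertices : (d : ℕ) → List (Vec Bool d)
allVertices zero = [] ∷ []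
allVertices (suc d) = concatMap (λ v → (false ∷ v) ∷ (true ∷ v) ∷ []) (allVertices d)

-- An edge of Q_d, represented uniquely by its endpoint with v_i = 0
-- together with its direction i = i(e).
record Edge (d : ℕ) : Set where
  constructor edge
  field
    low : Vec Bool d
    dir : Fin d

open Edge public

high : ∀ {d} → Edge d → Vec Bool d
high (edge v i) = v [ i ]%= not

allEdges : (d : ℕ) → List (Edge d)
allEdges d = concatMap (λ v → map (edge v) (filterᵇ (λ i → not (lookup v i)) (allFin d)))
                       (allVertices d)

-- A Max-2-LIN(Z_2) instance: false = equality edge (0), true = inequality edge (1)
Instance : ℕ → Set
Instance d = Edge d → Bool

Assignment : ℕ → Set
Assignment d = Vec Bool d → Bool

satisfies : ∀ {d} → Instance d → Assignment d → Edge d → Bool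
satisfies I σ e = does ((σ (low e) xor σ (high e)) ≟ᵇ I e)

unsatCount : ∀ {d} → Instance d → Assignment d → ℕ
unsatCount {d} I σ = length (filterᵇ (λ e → not (satisfies I σ e)) (allEdges d))

-- H(v[k]) = #{ j ∈ {k+1..d} : v_j = 1 }  (paper indexing; Fin index j has paper index toℕ j + 1)
H : ∀ {d} → ℕ → Vec Bool d → ℕ
H {d} k v = length (filterᵇ (λ j → (k <ᵇ suc (toℕ j)) ∧ lookup v j) (allFin d))

-- Δ[k,d]: the paper's condition  H(v1[k]) > (d-k)/2  is written exactly as  d < 2 H + k.
Δ : (k d : ℕ) → Instance d
Δ k d (edge v i) =
  if k <ᵇ suc (toℕ i) then false
  else (if d <ᵇ (2 * H k v + k) then false
        else true)

ℕ→ℚ : ℕ → ℚ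
ℕ→ℚ n = (+ n) / 1

-- Write Q_{k+n} = Q_k × Q_n. An edge of Δ[k, k+n] in one of the first k directions, from (x, w) to
-- (x′, w), is unsatisfied iff σ(x, w) ⊕ σ(x′, w) differs from L(w) = [|w| ≤ ⌊n/2⌋]; an edge in one of the
-- last n directions is unsatisfied iff σ changes along it. So for every edge (x, x′) of Q_k the function
-- g = σ(x, ·) ⊕ σ(x′, ·) on Q_n accounts for dist(g, L) unsatisfied edges, while its boundary ∂g is covered
-- by the unsatisfied edges in the copies of Q_n over x and over x′. Summing over the k·2^(k-1) edges of Q_k,
-- the theorem follows from the isoperimetric inequality  k·2ⁿ ≤ 8 (k·dist(g, L) + |∂g|)  for all
-- g : Q_n → Bool, once n ≥ 128k².
--
-- For the latter, take windows of t ≈ n/4k layers just below and just above the middle. Counting the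
-- edges between consecutive layers, the fraction of a layer on which g disagrees with L can grow, walking
-- towards layer ⌊n/2⌋ + 1, only through cut edges, and each layer of a window has at least k times the
-- size of the window seen so far in edges to the next one, so a cut edge is worth at most 1/k of a point.
-- On layer ⌊n/2⌋ + 1 the zeros and the ones of g make up the whole layer, so from one of the two sides
-- disagreement or cut edges must be proportional to the window, and by Chebyshev's inequality for the
-- weight (t² ≥ 2n) each window holds at least 2ⁿ/8 points.

module Submission where

open import Defs

module HypercubeCounting where

  open import Algebra.Bundles using (CommutativeRing)
  open import Data.Bool using (Bool; true; false; not; _xor_; _∧_; T; if_then_else_)
  open import Data.Bool.Properties using (xor-∧-commutativeRing; not-involutive; xor-comm; xor-identityʳ) renaming (_≟_ to _≟ᵇ_)
  open import Data.Empty using (⊥-elim)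
  open import Data.Fin using (Fin; zero; suc; toℕ; _↑ˡ_; _↑ʳ_)
  open import Data.Fin.Properties using (toℕ-↑ˡ; toℕ-↑ʳ; toℕ<n)
  open import Data.List as List using (List; []; _∷_; filterᵇ; length; concatMap; allFin)
  open import Data.Nat
  open import Data.Nat.Properties
  open import Data.Nat.DivMod using (_/_; m/n*n≤m; m≥n⇒m/n>0; m≡m%n+[m/n]*n; m%n<n)
  open import Data.Nat.Tactic.RingSolver using (solve-∀)
  open import Data.Sum using (inj₁; inj₂)
  open import Data.Unit using (tt)
  open import Data.Vec as Vec using (Vec; []; _∷_; lookup; _++_; replicate)
  open import Data.Vec.Properties using (lookup-++ˡ; lookup-++ʳ)
  open import Function using (_∘_)
  open import Relation.Binary.PropositionalEquality
  open import Relation.Nullary using (¬_; yes; no; does; proof; ofʸ; ofⁿ)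

  open import Algebra.Properties.CommutativeSemigroup
    (CommutativeRing.+-commutativeSemigroup xor-∧-commutativeRing) using () renaming (interchange to xor-interchange)

  open import Algebra.Properties.CommutativeSemigroup +-commutativeSemigroup
    using () renaming (interchange to +-interchange)

  *-≤1 : ∀ {x} y → x ≤ 1 → x * y ≤ y
  *-≤1 y x≤1 = ≤-trans (*-monoˡ-≤ y x≤1) (≤-reflexive (*-identityˡ y))

  ⌊n/2⌋+⌊n/2⌋≤n : ∀ n → ⌊ n /2⌋ + ⌊ n /2⌋ ≤ n
  ⌊n/2⌋+⌊n/2⌋≤n zero = z≤n
  ⌊n/2⌋+⌊n/2⌋≤n (suc zero) = z≤n
  ⌊n/2⌋+⌊n/2⌋≤n (suc (suc n)) = s≤s (subst (_≤ suc n) (sym (+-suc ⌊ n /2⌋ ⌊ n /2⌋)) (s≤s (⌊n/2⌋+⌊n/2⌋≤n n)))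

  n≤1+⌊n/2⌋+⌊n/2⌋ : ∀ n → n ≤ suc (⌊ n /2⌋ + ⌊ n /2⌋)
  n≤1+⌊n/2⌋+⌊n/2⌋ zero = z≤n
  n≤1+⌊n/2⌋+⌊n/2⌋ (suc zero) = s≤s z≤n
  n≤1+⌊n/2⌋+⌊n/2⌋ (suc (suc n)) =
    s≤s (subst (suc n ≤_) (cong suc (sym (+-suc ⌊ n /2⌋ ⌊ n /2⌋))) (s≤s (n≤1+⌊n/2⌋+⌊n/2⌋ n)))

  m<[1+m/n]*n : ∀ m n .{{_ : NonZero n}} → m < suc (m / n) * n
  m<[1+m/n]*n m n = subst (_< suc (m / n) * n) (sym (m≡m%n+[m/n]*n m n)) (+-monoˡ-< ((m / n) * n) (m%n<n m n))

  +≤⇒≤∣-∣ : ∀ {a b s} → a + s ≤ b → s ≤ ∣ a - b ∣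
  +≤⇒≤∣-∣ {a} {b} {s} a+s≤b =
    subst (s ≤_) (sym (m≤n⇒∣m-n∣≡n∸m (≤-trans (m≤m+n a s) a+s≤b))) (m+n≤o⇒m≤o∸n s (≤-trans (≤-reflexive (+-comm s a)) a+s≤b))

  increasing-steps : ∀ (f : ℕ → ℕ) {a b} → a ≤ b → (∀ i → a ≤ i → i < b → f i ≤ f (suc i)) → f a ≤ f b
  increasing-steps f {b = zero} z≤n _ = ≤-refl
  increasing-steps f {a} {suc b} a≤1+b step with m≤n⇒m<n∨m≡n a≤1+b
  ... | inj₂ refl = ≤-refl
  ... | inj₁ (s≤s a≤b) =
    ≤-trans (increasing-steps f a≤b (λ i a≤i i<b → step i a≤i (m<n⇒m<1+n i<b))) (step b a≤b ≤-refl)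

  decreasing-steps : ∀ (f : ℕ → ℕ) {a b} → a ≤ b → (∀ i → a ≤ i → i < b → f (suc i) ≤ f i) → f b ≤ f a
  decreasing-steps f {b = zero} z≤n _ = ≤-refl
  decreasing-steps f {a} {suc b} a≤1+b step with m≤n⇒m<n∨m≡n a≤1+b
  ... | inj₂ refl = ≤-refl
  ... | inj₁ (s≤s a≤b) =
    ≤-trans (step b a≤b ≤-refl) (decreasing-steps f a≤b (λ i a≤i i<b → step i a≤i (m<n⇒m<1+n i<b)))

  <ᵇ-true : ∀ {m n} → m < n → (m <ᵇ n) ≡ true
  <ᵇ-true {m} {n} m<n with m <ᵇ n | proof (m <? n)
  ... | true | _ = refl
  ... | false | ofⁿ m≮n = ⊥-elim (m≮n m<n)

  <ᵇ-false : ∀ {m n} → ¬ m < n → (m <ᵇ n) ≡ false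
  <ᵇ-false {m} {n} m≮n with m <ᵇ n | proof (m <? n)
  ... | true | ofʸ m<n = ⊥-elim (m≮n m<n)
  ... | false | _ = refl

  window-mass : ∀ {N} p s τ → N ≤ p + s + τ → 4 * p ≤ 3 * N → 8 * τ ≤ N → N ≤ 8 * s
  window-mass {N} p s τ covered p-small τ-small = +-cancelˡ-≤ (7 * N) N (8 * s) (begin
    7 * N + N                      ≡⟨ rearrange₁ N ⟩
    8 * N                          ≤⟨ *-monoʳ-≤ 8 covered ⟩
    8 * (p + s + τ)                ≡⟨ rearrange₂ p s τ ⟩
    2 * (4 * p) + 8 * s + 8 * τ    ≤⟨ +-mono-≤ (+-monoˡ-≤ (8 * s) (*-monoʳ-≤ 2 p-small)) τ-small ⟩
    2 * (3 * N) + 8 * s + N        ≡⟨ rearrange₃ N s ⟩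
    7 * N + 8 * s                  ∎)
    where
    open ≤-Reasoning
    rearrange₁ : ∀ N → 7 * N + N ≡ 8 * N
    rearrange₁ = solve-∀
    rearrange₂ : ∀ p s τ → 8 * (p + s + τ) ≡ 2 * (4 * p) + 8 * s + 8 * τ
    rearrange₂ = solve-∀
    rearrange₃ : ∀ N s → 2 * (3 * N) + 8 * s + N ≡ 7 * N + 8 * s
    rearrange₃ = solve-∀

  ⟦_⟧ : Bool → ℕ
  ⟦ true ⟧ = 1
  ⟦ false ⟧ = 0

  ⟦⟧≤1 : ∀ b → ⟦ b ⟧ ≤ 1
  ⟦⟧≤1 true = ≤-refl
  ⟦⟧≤1 false = z≤n

  ⟦⟧+⟦not⟧ : ∀ b → ⟦ b ⟧ + ⟦ not b ⟧ ≡ 1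
  ⟦⟧+⟦not⟧ true = refl
  ⟦⟧+⟦not⟧ false = refl

  ⟦xor⟧-subadditive : ∀ x y → ⟦ x xor y ⟧ ≤ ⟦ x ⟧ + ⟦ y ⟧
  ⟦xor⟧-subadditive true true = z≤n
  ⟦xor⟧-subadditive true false = ≤-refl
  ⟦xor⟧-subadditive false y = ≤-refl

  ⟦xor⟧-triangle : ∀ x y z → ⟦ x xor z ⟧ ≤ ⟦ x xor y ⟧ + ⟦ y xor z ⟧
  ⟦xor⟧-triangle true true true = z≤n
  ⟦xor⟧-triangle true true false = ≤-refl
  ⟦xor⟧-triangle true false true = z≤n
  ⟦xor⟧-triangle true false false = s≤s z≤n
  ⟦xor⟧-triangle false true true = s≤s z≤n
  ⟦xor⟧-triangle false true false = z≤n
  ⟦xor⟧-triangle false false true = ≤-refl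
  ⟦xor⟧-triangle false false false = z≤n

  sumFin : (n : ℕ) → (Fin n → ℕ) → ℕ
  sumFin zero f = 0
  sumFin (suc n) f = f zero + sumFin n (f ∘ suc)

  sumCube : (n : ℕ) → (Vec Bool n → ℕ) → ℕ
  sumCube zero f = f []
  sumCube (suc n) f = sumCube n (λ v → f (false ∷ v) + f (true ∷ v))

  sumBelow : ℕ → (ℕ → ℕ) → ℕ
  sumBelow zero f = 0
  sumBelow (suc t) f = sumBelow t f + f t

  sumFin-cong : ∀ n {f g : Fin n → ℕ} → (∀ i → f i ≡ g i) → sumFin n f ≡ sumFin n g
  sumFin-cong zero f≗g = refl
  sumFin-cong (suc n) f≗g = cong₂ _+_ (f≗g zero) (sumFin-cong n (f≗g ∘ suc))

  sumFin-+ : ∀ n (f g : Fin n → ℕ) → sumFin n (λ i → f i + g i) ≡ sumFin n f + sumFin n g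
  sumFin-+ zero f g = refl
  sumFin-+ (suc n) f g =
    trans (cong (f zero + g zero +_) (sumFin-+ n (f ∘ suc) (g ∘ suc))) (+-interchange (f zero) (g zero) _ _)

  sumFin-mono : ∀ n {f g : Fin n → ℕ} → (∀ i → f i ≤ g i) → sumFin n f ≤ sumFin n g
  sumFin-mono zero f≤g = z≤n
  sumFin-mono (suc n) f≤g = +-mono-≤ (f≤g zero) (sumFin-mono n (f≤g ∘ suc))

  sumFin-*ˡ : ∀ n c (f : Fin n → ℕ) → sumFin n (λ i → c * f i) ≡ c * sumFin n f
  sumFin-*ˡ zero c f = sym (*-zeroʳ c)
  sumFin-*ˡ (suc n) c f = trans (cong (c * f zero +_) (sumFin-*ˡ n c (f ∘ suc))) (sym (*-distribˡ-+ c _ _))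

  sumFin-*ʳ : ∀ n (f : Fin n → ℕ) c → sumFin n (λ i → f i * c) ≡ sumFin n f * c
  sumFin-*ʳ n f c = trans (sumFin-cong n (λ i → *-comm (f i) c)) (trans (sumFin-*ˡ n c f) (*-comm c _))

  sumFin-const : ∀ n c → sumFin n (λ _ → c) ≡ n * c
  sumFin-const zero c = refl
  sumFin-const (suc n) c = cong (c +_) (sumFin-const n c)

  sumFin-↑ : ∀ m n (f : Fin (m + n) → ℕ) →
    sumFin (m + n) f ≡ sumFin m (λ i → f (i ↑ˡ n)) + sumFin n (λ j → f (m ↑ʳ j))
  sumFin-↑ zero n f = refl
  sumFin-↑ (suc m) n f = trans (cong (f zero +_) (sumFin-↑ m n (f ∘ suc))) (sym (+-assoc (f zero) _ _))

  sumCube-cong : ∀ n {f g : Vec Bool n → ℕ} → (∀ v → f v ≡ g v) → sumCube n f ≡ sumCube n g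
  sumCube-cong zero f≗g = f≗g []
  sumCube-cong (suc n) f≗g = sumCube-cong n (λ v → cong₂ _+_ (f≗g (false ∷ v)) (f≗g (true ∷ v)))

  sumCube-+ : ∀ n (f g : Vec Bool n → ℕ) → sumCube n (λ v → f v + g v) ≡ sumCube n f + sumCube n g
  sumCube-+ zero f g = refl
  sumCube-+ (suc n) f g =
    trans (sumCube-cong n (λ v → +-interchange (f (false ∷ v)) (g (false ∷ v)) (f (true ∷ v)) (g (true ∷ v))))
          (sumCube-+ n _ _)

  sumCube-+₃ : ∀ n (f g h : Vec Bool n → ℕ) → sumCube n (λ v → f v + g v + h v) ≡ sumCube n f + sumCube n g + sumCube n h
  sumCube-+₃ n f g h = trans (sumCube-+ n _ h) (cong (_+ sumCube n h) (sumCube-+ n f g))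

  sumCube-+-cong : ∀ n {f f′ g g′ : Vec Bool n → ℕ} → sumCube n f ≡ sumCube n f′ → sumCube n g ≡ sumCube n g′ →
    sumCube n (λ v → f v + g v) ≡ sumCube n (λ v → f′ v + g′ v)
  sumCube-+-cong n {f} {f′} {g} {g′} f≡f′ g≡g′ =
    trans (sumCube-+ n f g) (trans (cong₂ _+_ f≡f′ g≡g′) (sym (sumCube-+ n f′ g′)))

  sumCube-mono : ∀ n {f g : Vec Bool n → ℕ} → (∀ v → f v ≤ g v) → sumCube n f ≤ sumCube n g
  sumCube-mono zero f≤g = f≤g []
  sumCube-mono (suc n) f≤g = sumCube-mono n (λ v → +-mono-≤ (f≤g (false ∷ v)) (f≤g (true ∷ v)))

  sumCube-*ˡ : ∀ n c (f : Vec Bool n → ℕ) → sumCube n (λ v → c * f v) ≡ c * sumCube n f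
  sumCube-*ˡ zero c f = refl
  sumCube-*ˡ (suc n) c f =
    trans (sumCube-cong n (λ v → sym (*-distribˡ-+ c (f (false ∷ v)) (f (true ∷ v))))) (sumCube-*ˡ n c _)

  sumCube-*ʳ : ∀ n (f : Vec Bool n → ℕ) c → sumCube n (λ v → f v * c) ≡ sumCube n f * c
  sumCube-*ʳ n f c = trans (sumCube-cong n (λ v → *-comm (f v) c)) (trans (sumCube-*ˡ n c f) (*-comm c _))

  sumCube-const : ∀ n c → sumCube n (λ _ → c) ≡ 2 ^ n * c
  sumCube-const zero c = sym (+-identityʳ c)
  sumCube-const (suc n) c = trans (sumCube-const n (c + c)) (lemma (2 ^ n) c)
    where
    lemma : ∀ p c → p * (c + c) ≡ 2 * p * c
    lemma = solve-∀

  2^n≤sumCube : ∀ n (f : Vec Bool n → ℕ) → (∀ v → 1 ≤ f v) → 2 ^ n ≤ sumCube n f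
  2^n≤sumCube n f 1≤f = ≤-trans (≤-reflexive (sym (trans (sumCube-const n 1) (*-identityʳ _)))) (sumCube-mono n 1≤f)

  sumCube-zero : ∀ n → sumCube n (λ _ → 0) ≡ 0
  sumCube-zero n = trans (sumCube-const n 0) (*-zeroʳ (2 ^ n))

  ≤-sumCube : ∀ n (f : Vec Bool n → ℕ) v → f v ≤ sumCube n f
  ≤-sumCube zero f [] = ≤-refl
  ≤-sumCube (suc n) f (false ∷ v) = ≤-trans (m≤m+n _ _) (≤-sumCube n _ v)
  ≤-sumCube (suc n) f (true ∷ v) = ≤-trans (m≤n+m _ _) (≤-sumCube n _ v)

  sumCube-++ : ∀ m n (f : Vec Bool (m + n) → ℕ) → sumCube (m + n) f ≡ sumCube m (λ x → sumCube n (λ w → f (x ++ w)))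
  sumCube-++ zero n f = refl
  sumCube-++ (suc m) n f = trans (sumCube-++ m n _) (sumCube-cong m (λ x → sumCube-+ n _ _))

  sumCube-map-not : ∀ n (f : Vec Bool n → ℕ) → sumCube n (f ∘ Vec.map not) ≡ sumCube n f
  sumCube-map-not zero f = refl
  sumCube-map-not (suc n) f =
    trans (sumCube-map-not n (λ v → f (true ∷ v) + f (false ∷ v))) (sumCube-cong n (λ v → +-comm (f (true ∷ v)) _))

  sumFin-sumCube : ∀ m n (F : Fin m → Vec Bool n → ℕ) →
    sumFin m (λ i → sumCube n (F i)) ≡ sumCube n (λ v → sumFin m (λ i → F i v))
  sumFin-sumCube zero n F = sym (sumCube-zero n)
  sumFin-sumCube (suc m) n F = trans (cong (sumCube n (F zero) +_) (sumFin-sumCube m n (F ∘ suc))) (sym (sumCube-+ n _ _))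

  sumBelow-*ʳ : ∀ t (f : ℕ → ℕ) c → sumBelow t (λ i → f i * c) ≡ sumBelow t f * c
  sumBelow-*ʳ zero f c = refl
  sumBelow-*ʳ (suc t) f c = trans (cong (_+ f t * c) (sumBelow-*ʳ t f c)) (sym (*-distribʳ-+ c (sumBelow t f) (f t)))

  sumBelow-≤-* : ∀ t {f : ℕ → ℕ} {c} → (∀ i → i < t → f i ≤ c) → sumBelow t f ≤ t * c
  sumBelow-≤-* zero f≤c = z≤n
  sumBelow-≤-* (suc t) {f} {c} f≤c = begin
    sumBelow t f + f t  ≤⟨ +-mono-≤ (sumBelow-≤-* t (λ i i<t → f≤c i (m<n⇒m<1+n i<t))) (f≤c t ≤-refl) ⟩
    t * c + c           ≡⟨ +-comm (t * c) c ⟩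
    suc t * c           ∎
    where open ≤-Reasoning

  sumBelow-suc : ∀ t (f : ℕ → ℕ) → sumBelow (suc t) f ≡ f 0 + sumBelow t (f ∘ suc)
  sumBelow-suc zero f = sym (+-identityʳ (f 0))
  sumBelow-suc (suc t) f = trans (cong (_+ f (suc t)) (sumBelow-suc t f)) (+-assoc (f 0) _ _)

  sumBelow-sumCube : ∀ t n (F : ℕ → Vec Bool n → ℕ) →
    sumBelow t (λ i → sumCube n (F i)) ≡ sumCube n (λ v → sumBelow t (λ i → F i v))
  sumBelow-sumCube zero n F = sym (sumCube-zero n)
  sumBelow-sumCube (suc t) n F = trans (cong (_+ sumCube n (F t)) (sumBelow-sumCube t n F)) (sym (sumCube-+ n _ _))

  sumBelow-≟-absent : ∀ t (f : ℕ → ℕ) x → (∀ i → i < t → x ≢ f i) → sumBelow t (λ i → ⟦ does (x ≟ f i) ⟧) ≡ 0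
  sumBelow-≟-absent zero f x _ = refl
  sumBelow-≟-absent (suc t) f x x∉f with x ≡ᵇ f t | proof (x ≟ f t)
  ... | true | ofʸ x≡fₜ = ⊥-elim (x∉f t ≤-refl x≡fₜ)
  ... | false | _ = trans (+-identityʳ _) (sumBelow-≟-absent t f x (λ i i<t → x∉f i (m<n⇒m<1+n i<t)))

  sumBelow-≟-≤1 : ∀ t (f : ℕ → ℕ) x → (∀ i j → i < t → j < t → f i ≡ f j → i ≡ j) →
    sumBelow t (λ i → ⟦ does (x ≟ f i) ⟧) ≤ 1
  sumBelow-≟-≤1 zero f x _ = z≤n
  sumBelow-≟-≤1 (suc t) f x f-injective with x ≡ᵇ f t | proof (x ≟ f t)
  ... | true | ofʸ x≡fₜ = ≤-reflexive (cong (_+ 1) (sumBelow-≟-absent t f x λ i i<t x≡fᵢ →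
          <-irrefl (f-injective i t (m<n⇒m<1+n i<t) ≤-refl (trans (sym x≡fᵢ) x≡fₜ)) i<t))
  ... | false | _ = ≤-trans (≤-reflexive (+-identityʳ _))
                            (sumBelow-≟-≤1 t f x (λ i j i<t j<t → f-injective i j (m<n⇒m<1+n i<t) (m<n⇒m<1+n j<t)))

  sumBelow-≟-present : ∀ t (f : ℕ → ℕ) x i → i < t → x ≡ f i → 1 ≤ sumBelow t (λ i → ⟦ does (x ≟ f i) ⟧)
  sumBelow-≟-present (suc t) f x i i<1+t x≡fᵢ with i ≟ t
  ... | no i≢t = ≤-trans (sumBelow-≟-present t f x i (≤∧≢⇒< (≤-pred i<1+t) i≢t) x≡fᵢ) (m≤m+n _ _)
  ... | yes refl with x ≡ᵇ f i | proof (x ≟ f i)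
  ...   | true | _ = m≤n+m 1 _
  ...   | false | ofⁿ x≢fᵢ = ⊥-elim (x≢fᵢ x≡fᵢ)

  -- Edges and layers of the hypercube

  flipAt : ∀ {n} → Vec Bool n → Fin n → Vec Bool n
  flipAt w j = w Vec.[ j ]%= not

  flipAt-involutive : ∀ {n} (w : Vec Bool n) j → flipAt (flipAt w j) j ≡ w
  flipAt-involutive (b ∷ w) zero = cong (_∷ w) (not-involutive b)
  flipAt-involutive (b ∷ w) (suc j) = cong (b ∷_) (flipAt-involutive w j)

  weight : ∀ {n} → Vec Bool n → ℕ
  weight [] = 0
  weight (b ∷ w) = ⟦ b ⟧ + weight w

  weight≡sumFin : ∀ {n} (w : Vec Bool n) → weight w ≡ sumFin n (λ j → ⟦ lookup w j ⟧)
  weight≡sumFin [] = refl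
  weight≡sumFin (b ∷ w) = cong (⟦ b ⟧ +_) (weight≡sumFin w)

  weight-map-not : ∀ {n} (w : Vec Bool n) → weight (Vec.map not w) + weight w ≡ n
  weight-map-not [] = refl
  weight-map-not (true ∷ w) = trans (+-suc _ (weight w)) (cong suc (weight-map-not w))
  weight-map-not (false ∷ w) = cong suc (weight-map-not w)

  suc-weight-flipAt : ∀ {n} (w : Vec Bool n) j → lookup w j ≡ true → suc (weight (flipAt w j)) ≡ weight w
  suc-weight-flipAt (true ∷ w) zero _ = refl
  suc-weight-flipAt (b ∷ w) (suc j) wⱼ≡true = trans (sym (+-suc ⟦ b ⟧ _)) (cong (⟦ b ⟧ +_) (suc-weight-flipAt w j wⱼ≡true))

  sumFin-zeros : ∀ {n} (w : Vec Bool n) → sumFin n (λ j → ⟦ not (lookup w j) ⟧) ≡ n ∸ weight w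
  sumFin-zeros {n} w = begin
    sumFin n (λ j → ⟦ not (lookup w j) ⟧)  ≡⟨ zeros≡ w ⟩
    weight (Vec.map not w)                ≡⟨ m+n∸n≡m _ (weight w) ⟨
    weight (Vec.map not w) + weight w ∸ weight w ≡⟨ cong (_∸ weight w) (weight-map-not w) ⟩
    n ∸ weight w                          ∎
    where
    open ≡-Reasoning
    zeros≡ : ∀ {n} (w : Vec Bool n) → sumFin n (λ j → ⟦ not (lookup w j) ⟧) ≡ weight (Vec.map not w)
    zeros≡ [] = refl
    zeros≡ (b ∷ w) = cong (⟦ not b ⟧ +_) (zeros≡ w)

  -- Each edge {w, flipAt w j} is counted once, at its endpoint with w_j = false, as in allEdges.
  sumEdges : (n : ℕ) → (Vec Bool n → Fin n → ℕ) → ℕ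
  sumEdges n F = sumCube n (λ w → sumFin n (λ j → ⟦ not (lookup w j) ⟧ * F w j))

  sumEdges-cong : ∀ n {F G : Vec Bool n → Fin n → ℕ} → (∀ w j → F w j ≡ G w j) → sumEdges n F ≡ sumEdges n G
  sumEdges-cong n F≗G = sumCube-cong n (λ w → sumFin-cong n (λ j → cong (⟦ not (lookup w j) ⟧ *_) (F≗G w j)))

  sumEdges-mono : ∀ n {F G : Vec Bool n → Fin n → ℕ} → (∀ w j → F w j ≤ G w j) → sumEdges n F ≤ sumEdges n G
  sumEdges-mono n F≤G = sumCube-mono n (λ w → sumFin-mono n (λ j → *-monoʳ-≤ ⟦ not (lookup w j) ⟧ (F≤G w j)))

  sumEdges-+ : ∀ n (F G : Vec Bool n → Fin n → ℕ) →
    sumEdges n (λ w j → F w j + G w j) ≡ sumEdges n F + sumEdges n G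
  sumEdges-+ n F G = trans (sumCube-cong n (λ w → trans (sumFin-cong n (λ j → *-distribˡ-+ ⟦ not (lookup w j) ⟧ _ _))
                                                        (sumFin-+ n _ _)))
                           (sumCube-+ n _ _)

  sumEdges-factorˡ : ∀ n (c : Vec Bool n → ℕ) (F : Vec Bool n → Fin n → ℕ) →
    sumEdges n (λ w j → c w * F w j) ≡ sumCube n (λ w → c w * sumFin n (λ j → ⟦ not (lookup w j) ⟧ * F w j))
  sumEdges-factorˡ n c F =
    sumCube-cong n (λ w → trans (sumFin-cong n (λ j → swap ⟦ not (lookup w j) ⟧ (c w) (F w j))) (sumFin-*ˡ n (c w) _))
    where
    swap : ∀ x y z → x * (y * z) ≡ y * (x * z)
    swap = solve-∀

  sumEdges-*ˡ : ∀ n c (F : Vec Bool n → Fin n → ℕ) → sumEdges n (λ w j → c * F w j) ≡ c * sumEdges n F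
  sumEdges-*ˡ n c F = trans (sumEdges-factorˡ n (λ _ → c) F) (sumCube-*ˡ n c _)

  sumEdges-byHigh : ∀ n (F : Vec Bool n → Fin n → ℕ) →
    sumEdges n F ≡ sumCube n (λ w → sumFin n (λ j → ⟦ lookup w j ⟧ * F (flipAt w j) j))
  sumEdges-byHigh zero F = refl
  sumEdges-byHigh (suc n) F = begin
      sumCube n (λ x → (F₀ x + 0 + P false x) + (0 + P true x))
    ≡⟨ sumCube-cong n (λ x → regroup (F₀ x) (P false x) (P true x)) ⟩
      sumCube n (λ x → F₀ x + (P false x + P true x))
    ≡⟨ sumCube-+-cong n {F₀} refl (sumCube-+-cong n (IH false) (IH true)) ⟩
      sumCube n (λ x → F₀ x + (P′ false x + P′ true x))
    ≡⟨ sumCube-cong n (λ x → regroup′ (F₀ x) (P′ false x) (P′ true x)) ⟩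
      sumCube n (λ x → (0 + P′ false x) + (F₀ x + 0 + P′ true x))
    ∎
    where
    open ≡-Reasoning
    F₀ : Vec Bool n → ℕ
    F₀ x = F (false ∷ x) zero
    P P′ : Bool → Vec Bool n → ℕ
    P b x = sumFin n (λ i → ⟦ not (lookup x i) ⟧ * F (b ∷ x) (suc i))
    P′ b x = sumFin n (λ i → ⟦ lookup x i ⟧ * F (b ∷ flipAt x i) (suc i))
    IH : ∀ b → sumCube n (P b) ≡ sumCube n (P′ b)
    IH b = sumEdges-byHigh n (λ x i → F (b ∷ x) (suc i))
    regroup : ∀ a p q → (a + 0 + p) + (0 + q) ≡ a + (p + q)
    regroup = solve-∀
    regroup′ : ∀ a p q → a + (p + q) ≡ (0 + p) + (a + 0 + q)
    regroup′ = solve-∀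

  edgeCount : ∀ n → 2 * sumEdges n (λ _ _ → 1) ≡ n * 2 ^ n
  edgeCount n = begin
      E + (E + 0)
    ≡⟨ cong (E +_) (trans (+-identityʳ E) (sumEdges-byHigh n _)) ⟩
      E + sumCube n (λ w → sumFin n (λ j → ⟦ lookup w j ⟧ * 1))
    ≡⟨ sumCube-+ n _ _ ⟨
      sumCube n (λ w → sumFin n (λ j → ⟦ not (lookup w j) ⟧ * 1) + sumFin n (λ j → ⟦ lookup w j ⟧ * 1))
    ≡⟨ sumCube-cong n (λ w → trans (sym (sumFin-+ n _ _)) (trans (sumFin-cong n (λ j → ones (lookup w j))) (trans (sumFin-const n 1) (*-identityʳ n)))) ⟩
      sumCube n (λ _ → n)
    ≡⟨ trans (sumCube-const n n) (*-comm (2 ^ n) n) ⟩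
      n * 2 ^ n
    ∎
    where
    open ≡-Reasoning
    E = sumEdges n (λ _ _ → 1)
    ones : ∀ b → ⟦ not b ⟧ * 1 + ⟦ b ⟧ * 1 ≡ 1
    ones true = refl
    ones false = refl

  layer : ∀ {n} → ℕ → Vec Bool n → ℕ
  layer a w = ⟦ does (weight w ≟ a) ⟧

  layer-*-cong : ∀ {n} a (w : Vec Bool n) {x y} → (weight w ≡ a → x ≡ y) → layer a w * x ≡ layer a w * y
  layer-*-cong a w x≡y with weight w ≡ᵇ a | proof (weight w ≟ a)
  ... | true | ofʸ weight≡a = cong (_+ 0) (x≡y weight≡a)
  ... | false | ofⁿ _ = refl

  layer-≡ : ∀ {n} a (w : Vec Bool n) → weight w ≡ a → layer a w ≡ 1
  layer-≡ a w weight≡a with weight w ≡ᵇ a | proof (weight w ≟ a)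
  ... | true | _ = refl
  ... | false | ofⁿ weight≢a = ⊥-elim (weight≢a weight≡a)

  layer-≢ : ∀ {n} a (w : Vec Bool n) → weight w ≢ a → layer a w ≡ 0
  layer-≢ a w weight≢a with weight w ≡ᵇ a | proof (weight w ≟ a)
  ... | true | ofʸ weight≡a = ⊥-elim (weight≢a weight≡a)
  ... | false | _ = refl

  layer-flipAt : ∀ {n} a (w : Vec Bool n) j → lookup w j ≡ true → layer a (flipAt w j) ≡ layer (suc a) w
  layer-flipAt a w j wⱼ≡true rewrite sym (suc-weight-flipAt w j wⱼ≡true) = refl

  sumEdges-fromLayer : ∀ n a (h : Vec Bool n → ℕ) →
    sumEdges n (λ w _ → layer a w * h w) ≡ sumCube n (λ w → layer a w * h w) * (n ∸ a)
  sumEdges-fromLayer n a h = trans (sumCube-cong n atVertex) (sumCube-*ʳ n _ (n ∸ a))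
    where
    open ≡-Reasoning
    atVertex : ∀ w → sumFin n (λ j → ⟦ not (lookup w j) ⟧ * (layer a w * h w)) ≡ layer a w * h w * (n ∸ a)
    atVertex w = begin
      sumFin n (λ j → ⟦ not (lookup w j) ⟧ * (layer a w * h w)) ≡⟨ sumFin-*ʳ n _ _ ⟩
      sumFin n (λ j → ⟦ not (lookup w j) ⟧) * (layer a w * h w) ≡⟨ cong (_* (layer a w * h w)) (sumFin-zeros w) ⟩
      (n ∸ weight w) * (layer a w * h w)                       ≡⟨ rotate (n ∸ weight w) (layer a w) (h w) ⟩
      layer a w * (h w * (n ∸ weight w))                       ≡⟨ layer-*-cong a w (cong (λ b → h w * (n ∸ b))) ⟩
      layer a w * (h w * (n ∸ a))                              ≡⟨ *-assoc (layer a w) (h w) (n ∸ a) ⟨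
      layer a w * h w * (n ∸ a)                                ∎
      where
      rotate : ∀ x y z → x * (y * z) ≡ y * (z * x)
      rotate = solve-∀

  sumEdges-intoLayer : ∀ n a (h : Vec Bool n → ℕ) →
    sumEdges n (λ w j → layer a w * h (flipAt w j)) ≡ sumCube n (λ w → layer (suc a) w * h w) * suc a
  sumEdges-intoLayer n a h =
    trans (sumEdges-byHigh n (λ w j → layer a w * h (flipAt w j)))
          (trans (sumCube-cong n atVertex) (sumCube-*ʳ n _ (suc a)))
    where
    open ≡-Reasoning
    atEdge : ∀ w j → ⟦ lookup w j ⟧ * (layer a (flipAt w j) * h (flipAt (flipAt w j) j))
                   ≡ ⟦ lookup w j ⟧ * (layer (suc a) w * h w)
    atEdge w j with lookup w j in wⱼ
    ... | false = refl
    ... | true rewrite layer-flipAt a w j wⱼ | flipAt-involutive w j = refl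
    atVertex : ∀ w → sumFin n (λ j → ⟦ lookup w j ⟧ * (layer a (flipAt w j) * h (flipAt (flipAt w j) j)))
                   ≡ layer (suc a) w * h w * suc a
    atVertex w = begin
      sumFin n (λ j → ⟦ lookup w j ⟧ * (layer a (flipAt w j) * h (flipAt (flipAt w j) j)))
        ≡⟨ trans (sumFin-cong n (atEdge w)) (sumFin-*ʳ n _ _) ⟩
      sumFin n (λ j → ⟦ lookup w j ⟧) * (layer (suc a) w * h w)
        ≡⟨ cong (_* (layer (suc a) w * h w)) (weight≡sumFin w) ⟨
      weight w * (layer (suc a) w * h w)
        ≡⟨ rotate (weight w) (layer (suc a) w) (h w) ⟩
      layer (suc a) w * (h w * weight w)
        ≡⟨ layer-*-cong (suc a) w (cong (h w *_)) ⟩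
      layer (suc a) w * (h w * suc a)
        ≡⟨ *-assoc (layer (suc a) w) (h w) (suc a) ⟨
      layer (suc a) w * h w * suc a
        ∎
      where
      rotate : ∀ x y z → x * (y * z) ≡ y * (z * x)
      rotate = solve-∀

  layerSize : ℕ → ℕ → ℕ
  layerSize n a = sumCube n (layer a)

  layerSize-step : ∀ n a → layerSize n a * (n ∸ a) ≡ layerSize n (suc a) * suc a
  layerSize-step n a = begin
    layerSize n a * (n ∸ a)                            ≡⟨ cong (_* (n ∸ a)) (sumCube-cong n (λ w → *-identityʳ (layer a w))) ⟨
    sumCube n (λ w → layer a w * 1) * (n ∸ a)           ≡⟨ sumEdges-fromLayer n a (λ _ → 1) ⟨
    sumEdges n (λ w _ → layer a w * 1)                  ≡⟨ sumEdges-intoLayer n a (λ _ → 1) ⟩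
    sumCube n (λ w → layer (suc a) w * 1) * suc a       ≡⟨ cong (_* suc a) (sumCube-cong n (λ w → *-identityʳ (layer (suc a) w))) ⟩
    layerSize n (suc a) * suc a                        ∎
    where open ≡-Reasoning

  module LayerCounts {n} (g : Vec Bool n → Bool) where

    boundaryAt : Vec Bool n → ℕ
    boundaryAt w = sumFin n (λ j → ⟦ not (lookup w j) ⟧ * ⟦ g w xor g (flipAt w j) ⟧)

    cut : ℕ → ℕ
    cut a = sumCube n (λ w → layer a w * boundaryAt w)

    misses : Bool → ℕ → ℕ
    misses c a = sumCube n (λ w → layer a w * ⟦ c xor g w ⟧)

    misses-true+false : ∀ a → misses true a + misses false a ≡ layerSize n a
    misses-true+false a =
      trans (sym (sumCube-+ n _ _)) (sumCube-cong n (λ w →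
        trans (sym (*-distribˡ-+ (layer a w) _ _)) (trans (cong (layer a w *_) (partition (g w))) (*-identityʳ _))))
      where
      partition : ∀ b → ⟦ true xor b ⟧ + ⟦ false xor b ⟧ ≡ 1
      partition true = refl
      partition false = refl

    private
      cutEdge : Vec Bool n → Fin n → ℕ
      cutEdge w j = ⟦ g w xor g (flipAt w j) ⟧

      split-cut : ∀ a (F : Vec Bool n → Fin n → ℕ) →
        sumEdges n (λ w j → layer a w * (F w j + cutEdge w j)) ≡ sumEdges n (λ w j → layer a w * F w j) + cut a
      split-cut a F =
        trans (sumEdges-cong n (λ w j → *-distribˡ-+ (layer a w) (F w j) (cutEdge w j)))
              (trans (sumEdges-+ n _ _) (cong (_ +_) (sumEdges-factorˡ n (layer a) cutEdge)))

    misses-up : ∀ c a → misses c (suc a) * suc a ≤ cut a + misses c a * (n ∸ a)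
    misses-up c a = begin
      misses c (suc a) * suc a
        ≡⟨ sumEdges-intoLayer n a (λ w → ⟦ c xor g w ⟧) ⟨
      sumEdges n (λ w j → layer a w * ⟦ c xor g (flipAt w j) ⟧)
        ≤⟨ sumEdges-mono n (λ w j → *-monoʳ-≤ (layer a w) (⟦xor⟧-triangle c (g w) (g (flipAt w j)))) ⟩
      sumEdges n (λ w j → layer a w * (⟦ c xor g w ⟧ + cutEdge w j))
        ≡⟨ split-cut a _ ⟩
      sumEdges n (λ w _ → layer a w * ⟦ c xor g w ⟧) + cut a
        ≡⟨ cong (_+ cut a) (sumEdges-fromLayer n a (λ w → ⟦ c xor g w ⟧)) ⟩
      misses c a * (n ∸ a) + cut a
        ≡⟨ +-comm _ (cut a) ⟩
      cut a + misses c a * (n ∸ a)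
        ∎
      where open ≤-Reasoning

    misses-down : ∀ c a → misses c a * (n ∸ a) ≤ cut a + misses c (suc a) * suc a
    misses-down c a = begin
      misses c a * (n ∸ a)
        ≡⟨ sumEdges-fromLayer n a (λ w → ⟦ c xor g w ⟧) ⟨
      sumEdges n (λ w _ → layer a w * ⟦ c xor g w ⟧)
        ≤⟨ sumEdges-mono n (λ w j → *-monoʳ-≤ (layer a w) (triangle (g w) (g (flipAt w j)))) ⟩
      sumEdges n (λ w j → layer a w * (⟦ c xor g (flipAt w j) ⟧ + cutEdge w j))
        ≡⟨ split-cut a _ ⟩
      sumEdges n (λ w j → layer a w * ⟦ c xor g (flipAt w j) ⟧) + cut a
        ≡⟨ cong (_+ cut a) (sumEdges-intoLayer n a (λ w → ⟦ c xor g w ⟧)) ⟩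
      misses c (suc a) * suc a + cut a
        ≡⟨ +-comm _ (cut a) ⟩
      cut a + misses c (suc a) * suc a
        ∎
      where
      open ≤-Reasoning
      triangle : ∀ x y → ⟦ c xor x ⟧ ≤ ⟦ c xor y ⟧ + ⟦ x xor y ⟧
      triangle x y = subst (λ b → ⟦ c xor x ⟧ ≤ ⟦ c xor y ⟧ + ⟦ b ⟧) (xor-comm y x) (⟦xor⟧-triangle c y x)

  -- Propagation of densities between layers

  -- Read as Y t / C t ≤ (Σ Y + Σ cut / k) / Σ C over the earlier steps: the density of Y can only rise
  -- through cut edges, and C-slow makes each cut edge worth at most 1/k of the mass already seen.
  module DensityPropagation (k T : ℕ) (C Y cut α β : ℕ → ℕ)
    (Y-step : ∀ i → i < T → Y (suc i) * β i ≤ cut i + Y i * α i)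
    (C-step : ∀ i → i < T → C i * α i ≡ C (suc i) * β i)
    (C-slow : ∀ i → i < T → k * sumBelow (suc i) C ≤ C i * α i)
    (C-pos : ∀ i → i ≤ T → 0 < C i) where

    density-bound : ∀ t → t ≤ T → k * sumBelow t C * Y t ≤ C t * (k * sumBelow t Y + sumBelow t cut)
    density-bound zero _ rewrite *-zeroʳ k = z≤n
    density-bound (suc t) t<T = *-cancelˡ-≤ c {{>-nonZero (C-pos t (<⇒≤ t<T))}} (begin
        c * (k * S′ * y′)
      ≡⟨ rearrange₁ c k S′ y′ ⟩
        k * S′ * (c * y′)
      ≤⟨ *-monoʳ-≤ (k * S′) (m≤n+m∸n (c * y′) (c′ * y)) ⟩
        k * S′ * (c′ * y + (c * y′ ∸ c′ * y))
      ≡⟨ *-distribˡ-+ (k * S′) (c′ * y) _ ⟩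
        k * S′ * (c′ * y) + k * S′ * (c * y′ ∸ c′ * y)
      ≤⟨ +-monoʳ-≤ (k * S′ * (c′ * y)) (≤-trans (*-monoˡ-≤ _ (C-slow t t<T)) increase) ⟩
        k * S′ * (c′ * y) + c * c′ * cut t
      ≡⟨ cong (_+ c * c′ * cut t) (rearrange₂ k S c c′ y) ⟩
        c′ * (k * S * y) + c * c′ * (k * y) + c * c′ * cut t
      ≤⟨ +-monoˡ-≤ _ (+-monoˡ-≤ _ (*-monoʳ-≤ c′ (density-bound t (<⇒≤ t<T)))) ⟩
        c′ * (c * (k * ΣY + Σcut)) + c * c′ * (k * y) + c * c′ * cut t
      ≡⟨ rearrange₃ c c′ k ΣY Σcut y (cut t) ⟩
        c * (c′ * (k * (ΣY + y) + (Σcut + cut t)))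
      ∎)
      where
      open ≤-Reasoning
      c = C t
      c′ = C (suc t)
      y = Y t
      y′ = Y (suc t)
      S = sumBelow t C
      S′ = S + c
      ΣY = sumBelow t Y
      Σcut = sumBelow t cut

      rearrange₁ : ∀ c k S y → c * (k * S * y) ≡ k * S * (c * y)
      rearrange₁ = solve-∀
      rearrange₂ : ∀ k S c c′ y → k * (S + c) * (c′ * y) ≡ c′ * (k * S * y) + c * c′ * (k * y)
      rearrange₂ = solve-∀
      rearrange₃ : ∀ c c′ k ΣY Σcut y x →
        c′ * (c * (k * ΣY + Σcut)) + c * c′ * (k * y) + c * c′ * x ≡ c * (c′ * (k * (ΣY + y) + (Σcut + x)))
      rearrange₃ = solve-∀
      rearrange₄ : ∀ c′ b c y′ → c′ * b * (c * y′) ≡ c * c′ * (y′ * b)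
      rearrange₄ = solve-∀
      rearrange₅ : ∀ c c′ x y a → c * c′ * (x + y * a) ≡ c * c′ * x + c * a * (c′ * y)
      rearrange₅ = solve-∀

      increase : c * α t * (c * y′ ∸ c′ * y) ≤ c * c′ * cut t
      increase = begin
        c * α t * (c * y′ ∸ c′ * y)                  ≡⟨ *-distribˡ-∸ (c * α t) (c * y′) (c′ * y) ⟩
        c * α t * (c * y′) ∸ c * α t * (c′ * y)      ≤⟨ m≤n+o⇒m∸n≤o _ _ (≤-trans upper (≤-reflexive (+-comm (c * c′ * cut t) _))) ⟩
        c * c′ * cut t                               ∎
        where
        upper : c * α t * (c * y′) ≤ c * c′ * cut t + c * α t * (c′ * y)
        upper = begin
          c * α t * (c * y′)             ≡⟨ cong (_* (c * y′)) (C-step t t<T) ⟩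
          c′ * β t * (c * y′)            ≡⟨ rearrange₄ c′ (β t) c y′ ⟩
          c * c′ * (y′ * β t)            ≤⟨ *-monoʳ-≤ (c * c′) (Y-step t t<T) ⟩
          c * c′ * (cut t + y * α t)     ≡⟨ rearrange₅ c c′ (cut t) y (α t) ⟩
          c * c′ * cut t + c * α t * (c′ * y) ∎

  weight-replicate-false : ∀ n → weight (replicate n false) ≡ 0
  weight-replicate-false zero = refl
  weight-replicate-false (suc n) = weight-replicate-false n

  layerSize-pos : ∀ n a → a ≤ n → 0 < layerSize n a
  layerSize-pos n zero _ = ≤-trans (≤-reflexive (sym (layer-≡ 0 (replicate n false) (weight-replicate-false n))))
                                   (≤-sumCube n (layer 0) (replicate n false))
  layerSize-pos n (suc a) 1+a≤n = positive (layerSize-pos n a (<⇒≤ 1+a≤n)) (m<n⇒0<n∸m 1+a≤n) (layerSize-step n a)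
    where
    positive : ∀ {x y z} → 0 < x → 0 < z → x * z ≡ y * suc a → 0 < y
    positive {y = suc _} _ _ _ = z<s
    positive {suc x} {zero} {suc z} _ _ ()

  module _ (n : ℕ) where

    private
      m = ⌊ n /2⌋

    layerSize-increasing : ∀ {a b} → a ≤ b → b ≤ m → layerSize n a ≤ layerSize n b
    layerSize-increasing {a} {b} a≤b b≤m = increasing-steps (layerSize n) a≤b step
      where
      step : ∀ i → a ≤ i → i < b → layerSize n i ≤ layerSize n (suc i)
      step i _ i<b = *-cancelʳ-≤ _ _ (n ∸ i) {{>-nonZero (<-≤-trans z<s 1+i≤n∸i)}}
        (≤-trans (≤-reflexive (layerSize-step n i)) (*-monoʳ-≤ (layerSize n (suc i)) 1+i≤n∸i))
        where
        1+i≤n∸i : suc i ≤ n ∸ i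
        1+i≤n∸i = m+n≤o⇒m≤o∸n (suc i) (≤-trans (+-mono-≤ (≤-trans i<b b≤m) (<⇒≤ (<-≤-trans i<b b≤m))) (⌊n/2⌋+⌊n/2⌋≤n n))

    layerSize-decreasing : ∀ {a b} → m ≤ a → a ≤ b → layerSize n b ≤ layerSize n a
    layerSize-decreasing {a} {b} m≤a a≤b = decreasing-steps (layerSize n) a≤b step
      where
      step : ∀ i → a ≤ i → i < b → layerSize n (suc i) ≤ layerSize n i
      step i a≤i _ = *-cancelʳ-≤ _ _ (suc i) (≤-trans (≤-reflexive (sym (layerSize-step n i))) (*-monoʳ-≤ (layerSize n i) n∸i≤1+i))
        where
        n∸i≤1+i : n ∸ i ≤ suc i
        n∸i≤1+i = m≤n+o⇒m∸n≤o n i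
          (≤-trans (n≤1+⌊n/2⌋+⌊n/2⌋ n) (≤-trans (+-mono-≤ (s≤s (≤-trans m≤a a≤i)) (≤-trans m≤a a≤i)) (≤-reflexive (+-comm (suc i) i))))

  -- The two halves of the cube and the variance of the weight

  lowerHalf : ∀ {n} → Vec Bool n → Bool
  lowerHalf {n} w = does (weight w ≤? ⌊ n /2⌋)

  module HalfMasses (n : ℕ) where

    private
      m = ⌊ n /2⌋
      P = sumCube n (λ w → ⟦ lowerHalf w ⟧)
      Q = sumCube n (λ w → ⟦ not (lowerHalf w) ⟧)

      complement-upper : ∀ (w : Vec Bool n) → m < weight (Vec.map not w) → weight w ≤ m
      complement-upper w m<w̄ = +-cancelˡ-≤ (suc m) (weight w) m
        (≤-trans (+-monoˡ-≤ (weight w) m<w̄) (≤-trans (≤-reflexive (weight-map-not w)) (n≤1+⌊n/2⌋+⌊n/2⌋ n)))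

      complement-lower : ∀ (w : Vec Bool n) → weight (Vec.map not w) ≤ m → m ≤ weight w
      complement-lower w w̄≤m = +-cancelˡ-≤ m m (weight w)
        (≤-trans (⌊n/2⌋+⌊n/2⌋≤n n) (≤-trans (≤-reflexive (sym (weight-map-not w))) (+-monoˡ-≤ (weight w) w̄≤m)))

      P+Q : P + Q ≡ 2 ^ n
      P+Q = trans (sym (sumCube-+ n _ _))
                  (trans (sumCube-cong n (λ w → ⟦⟧+⟦not⟧ (lowerHalf w))) (trans (sumCube-const n 1) (*-identityʳ _)))

      Q≤P : Q ≤ P
      Q≤P = ≤-trans (≤-reflexive (sym (sumCube-map-not n _))) (sumCube-mono n atVertex)
        where
        atVertex : ∀ (w : Vec Bool n) → ⟦ not (lowerHalf (Vec.map not w)) ⟧ ≤ ⟦ lowerHalf w ⟧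
        atVertex w with weight (Vec.map not w) ≤ᵇ m | proof (weight (Vec.map not w) ≤? m)
                      | weight w ≤ᵇ m | proof (weight w ≤? m)
        ... | true | _ | _ | _ = z≤n
        ... | false | _ | true | _ = ≤-refl
        ... | false | ofⁿ w̄≰m | false | ofⁿ w≰m = ⊥-elim (w≰m (complement-upper w (≰⇒> w̄≰m)))

      P≤Q+middle : P ≤ Q + layerSize n m
      P≤Q+middle = ≤-trans (≤-reflexive (sym (sumCube-map-not n _))) (≤-trans (sumCube-mono n atVertex) (≤-reflexive (sumCube-+ n _ _)))
        where
        atVertex : ∀ (w : Vec Bool n) → ⟦ lowerHalf (Vec.map not w) ⟧ ≤ ⟦ not (lowerHalf w) ⟧ + layer m w
        atVertex w with weight (Vec.map not w) ≤ᵇ m | proof (weight (Vec.map not w) ≤? m)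
                      | weight w ≤ᵇ m | proof (weight w ≤? m)
        ... | false | _ | _ | _ = z≤n
        ... | true | _ | false | _ = s≤s z≤n
        ... | true | ofʸ w̄≤m | true | ofʸ w≤m =
              ≤-reflexive (sym (layer-≡ m w (≤-antisym w≤m (complement-lower w w̄≤m))))

      middle≤2next : 1 ≤ m → layerSize n m ≤ 2 * layerSize n (suc m)
      middle≤2next 1≤m = *-cancelʳ-≤ (layerSize n m) (2 * layerSize n (suc m)) m {{>-nonZero 1≤m}} (begin
        layerSize n m * m                  ≤⟨ *-monoʳ-≤ (layerSize n m) (m+n≤o⇒m≤o∸n m (⌊n/2⌋+⌊n/2⌋≤n n)) ⟩
        layerSize n m * (n ∸ m)            ≡⟨ layerSize-step n m ⟩
        layerSize n (suc m) * suc m        ≤⟨ *-monoʳ-≤ (layerSize n (suc m)) (+-monoˡ-≤ m 1≤m) ⟩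
        layerSize n (suc m) * (m + m)      ≡⟨ rearrange (layerSize n (suc m)) m ⟩
        2 * layerSize n (suc m) * m        ∎)
        where
        open ≤-Reasoning
        rearrange : ∀ c m → c * (m + m) ≡ 2 * c * m
        rearrange = solve-∀

      next≤Q : layerSize n (suc m) ≤ Q
      next≤Q = sumCube-mono n atVertex
        where
        atVertex : ∀ (w : Vec Bool n) → layer (suc m) w ≤ ⟦ not (lowerHalf w) ⟧
        atVertex w with weight w ≤ᵇ m | proof (weight w ≤? m)
        ... | false | _ = ⟦⟧≤1 _
        ... | true | ofʸ w≤m = ≤-reflexive (layer-≢ (suc m) w (λ w≡1+m → <-irrefl w≡1+m (s≤s w≤m)))

    upperHalf-mass : 4 * Q ≤ 3 * 2 ^ n
    upperHalf-mass = begin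
      4 * Q          ≡⟨ rearrange Q ⟩
      2 * (Q + Q)    ≤⟨ *-monoʳ-≤ 2 (+-monoˡ-≤ Q Q≤P) ⟩
      2 * (P + Q)    ≡⟨ cong (2 *_) P+Q ⟩
      2 * 2 ^ n      ≤⟨ *-monoˡ-≤ (2 ^ n) (n≤1+n 2) ⟩
      3 * 2 ^ n      ∎
      where
      open ≤-Reasoning
      rearrange : ∀ q → 4 * q ≡ 2 * (q + q)
      rearrange = solve-∀

    lowerHalf-mass : 1 ≤ m → 4 * P ≤ 3 * 2 ^ n
    lowerHalf-mass 1≤m = begin
      4 * P                                ≡⟨ rearrange P ⟩
      3 * P + P                            ≤⟨ +-monoʳ-≤ (3 * P) P≤3Q ⟩
      3 * P + 3 * Q                        ≡⟨ trans (sym (*-distribˡ-+ 3 P Q)) (cong (3 *_) P+Q) ⟩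
      3 * 2 ^ n                            ∎
      where
      open ≤-Reasoning
      rearrange : ∀ p → 4 * p ≡ 3 * p + p
      rearrange = solve-∀
      P≤3Q : P ≤ 3 * Q
      P≤3Q = ≤-trans P≤Q+middle (+-monoʳ-≤ Q (≤-trans (middle≤2next 1≤m) (*-monoʳ-≤ 2 next≤Q)))

  gap : ∀ {n} → Vec Bool n → ℕ
  gap w = ∣ weight w - weight (Vec.map not w) ∣

  sumCube-gap² : ∀ n → sumCube n (λ w → gap w * gap w) ≡ n * 2 ^ n
  sumCube-gap² zero = refl
  sumCube-gap² (suc n) = begin
    sumCube n (λ v → gap (false ∷ v) * gap (false ∷ v) + gap (true ∷ v) * gap (true ∷ v))
      ≡⟨ sumCube-cong n (λ v → step (weight v) (weight (Vec.map not v))) ⟩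
    sumCube n (λ v → 2 * (gap v * gap v) + 2)
      ≡⟨ sumCube-+ n _ _ ⟩
    sumCube n (λ v → 2 * (gap v * gap v)) + sumCube n (λ _ → 2)
      ≡⟨ cong₂ _+_ (trans (sumCube-*ˡ n 2 _) (cong (2 *_) (sumCube-gap² n))) (sumCube-const n 2) ⟩
    2 * (n * 2 ^ n) + 2 ^ n * 2
      ≡⟨ rearrange n (2 ^ n) ⟩
    suc n * 2 ^ suc n
      ∎
    where
    open ≡-Reasoning
    rearrange : ∀ n p → 2 * (n * p) + p * 2 ≡ suc n * (2 * p)
    rearrange = solve-∀
    step : ∀ a b → ∣ a - suc b ∣ * ∣ a - suc b ∣ + ∣ suc a - b ∣ * ∣ suc a - b ∣ ≡ 2 * (∣ a - b ∣ * ∣ a - b ∣) + 2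
    step zero zero = refl
    step zero (suc b) = lemma b
      where
      lemma : ∀ b → suc (suc b) * suc (suc b) + b * b ≡ 2 * (suc b * suc b) + 2
      lemma = solve-∀
    step (suc zero) zero = refl
    step (suc (suc a)) zero = lemma a
      where
      lemma : ∀ a → suc a * suc a + suc (suc (suc a)) * suc (suc (suc a)) ≡ 2 * (suc (suc a) * suc (suc a)) + 2
      lemma = solve-∀
    step (suc a) (suc b) = step a b

  chebyshev : ∀ n s (tail : Vec Bool n → Bool) → (∀ w → T (tail w) → s ≤ gap w) →
    s * s * sumCube n (λ w → ⟦ tail w ⟧) ≤ n * 2 ^ n
  chebyshev n s tail far = begin
    s * s * sumCube n (λ w → ⟦ tail w ⟧)  ≡⟨ sumCube-*ˡ n (s * s) _ ⟨
    sumCube n (λ w → s * s * ⟦ tail w ⟧)  ≤⟨ sumCube-mono n atVertex ⟩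
    sumCube n (λ w → gap w * gap w)       ≡⟨ sumCube-gap² n ⟩
    n * 2 ^ n                             ∎
    where
    open ≤-Reasoning
    atVertex : ∀ w → s * s * ⟦ tail w ⟧ ≤ gap w * gap w
    atVertex w with tail w | far w
    ... | false | _ = ≤-trans (≤-reflexive (*-zeroʳ (s * s))) z≤n
    ... | true | far-w = ≤-trans (≤-reflexive (*-identityʳ (s * s))) (*-mono-≤ (far-w tt) (far-w tt))

  -- Isoperimetry of the lower half

  boundary : ∀ {n} → (Vec Bool n → Bool) → ℕ
  boundary {n} g = sumEdges n (λ w j → ⟦ g w xor g (flipAt w j) ⟧)

  distance : ∀ {n} → (Vec Bool n → Bool) → (Vec Bool n → Bool) → ℕ
  distance {n} g h = sumCube n (λ w → ⟦ g w xor h w ⟧)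

  -- The low window consists of the layers lo, …, m, where lowerHalf holds, and the high window of the
  -- layers hi, hi ∸ 1, …, m + 1, where it fails; both are walked towards layer m + 1 = lo + t = hi ∸ t.
  module Windows (n k t : ℕ) (1≤k : 1 ≤ k) (1≤t : 1 ≤ t) (2kt≤m : 2 * k * t ≤ ⌊ n /2⌋) (2n≤t² : 2 * n ≤ t * t) where

    private
      m = ⌊ n /2⌋
      lo = suc m ∸ t
      hi = suc m + t

      lowCount highCount : Vec Bool n → ℕ
      lowCount w = sumBelow t (λ i → layer (lo + i) w)
      highCount w = sumBelow (suc t) (λ i → layer (hi ∸ i) w)

      t≤kt : t ≤ k * t
      t≤kt = ≤-trans (≤-reflexive (sym (*-identityˡ t))) (*-monoˡ-≤ t 1≤k)

      kt+kt≤m : k * t + k * t ≤ m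
      kt+kt≤m = ≤-trans (≤-reflexive (rearrange k t)) 2kt≤m
        where
        rearrange : ∀ k t → k * t + k * t ≡ 2 * k * t
        rearrange = solve-∀

      kt≤m : k * t ≤ m
      kt≤m = ≤-trans (m≤m+n (k * t) (k * t)) kt+kt≤m

      1+t≤m : suc t ≤ m
      1+t≤m = ≤-trans (≤-reflexive (+-comm 1 t)) (≤-trans (+-monoʳ-≤ t 1≤t) (≤-trans (+-mono-≤ t≤kt t≤kt) kt+kt≤m))

      1≤m : 1 ≤ m
      1≤m = ≤-trans (s≤s z≤n) 1+t≤m

      1≤n : 1 ≤ n
      1≤n = ≤-trans 1≤m (≤-trans (m≤m+n m m) (⌊n/2⌋+⌊n/2⌋≤n n))

      m≤n∸m : m ≤ n ∸ m
      m≤n∸m = m+n≤o⇒m≤o∸n m (⌊n/2⌋+⌊n/2⌋≤n n)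

      hi≤n : hi ≤ n
      hi≤n = ≤-trans (≤-reflexive (sym (+-suc m t))) (≤-trans (+-monoʳ-≤ m 1+t≤m) (⌊n/2⌋+⌊n/2⌋≤n n))

      lo+t≡1+m : lo + t ≡ suc m
      lo+t≡1+m = m∸n+n≡m (m≤n⇒m≤1+n (≤-trans (n≤1+n t) 1+t≤m))

      hi∸t≡1+m : hi ∸ t ≡ suc m
      hi∸t≡1+m = m+n∸n≡m (suc m) t

      lo+i≤m : ∀ {i} → i < t → lo + i ≤ m
      lo+i≤m {i} i<t = ≤-pred (≤-trans (≤-reflexive (sym (+-suc lo i))) (≤-trans (+-monoʳ-≤ lo i<t) (≤-reflexive lo+t≡1+m)))

      1+m≤hi∸i : ∀ {i} → i ≤ t → suc m ≤ hi ∸ i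
      1+m≤hi∸i i≤t = ≤-trans (≤-reflexive (sym hi∸t≡1+m)) (∸-monoʳ-≤ hi i≤t)

      k*[1+i]≤m : ∀ {i} → i < t → k * suc i ≤ m
      k*[1+i]≤m i<t = ≤-trans (*-monoʳ-≤ k i<t) kt≤m

      lowTail highTail : Vec Bool n → Bool
      lowTail w = does (weight w + t ≤? m)
      highTail w = does (hi <? weight w)

      tail-mass : (tail : Vec Bool n → Bool) → (∀ w → T (tail w) → 2 * t ≤ gap w) →
        8 * sumCube n (λ w → ⟦ tail w ⟧) ≤ 2 ^ n
      tail-mass tail far = *-cancelˡ-≤ n {{>-nonZero 1≤n}} (begin
        n * (8 * τ)               ≡⟨ rearrange₁ n τ ⟩
        4 * (2 * n) * τ           ≤⟨ *-monoˡ-≤ τ (*-monoʳ-≤ 4 2n≤t²) ⟩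
        4 * (t * t) * τ           ≡⟨ cong (_* τ) (rearrange₂ t) ⟩
        2 * t * (2 * t) * τ       ≤⟨ chebyshev n (2 * t) tail far ⟩
        n * 2 ^ n                 ∎)
        where
        open ≤-Reasoning
        τ = sumCube n (λ w → ⟦ tail w ⟧)
        rearrange₁ : ∀ n τ → n * (8 * τ) ≡ 4 * (2 * n) * τ
        rearrange₁ = solve-∀
        rearrange₂ : ∀ t → 4 * (t * t) ≡ 2 * t * (2 * t)
        rearrange₂ = solve-∀

      lowTail-far : ∀ w → T (lowTail w) → 2 * t ≤ gap w
      lowTail-far w low = +≤⇒≤∣-∣ {a} {b} (+-cancelʳ-≤ a (a + 2 * t) b (begin
        a + 2 * t + a         ≡⟨ rearrange a t ⟩
        2 * (a + t)           ≤⟨ *-monoʳ-≤ 2 (≤ᵇ⇒≤ (a + t) m low) ⟩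
        2 * m                 ≡⟨ cong (m +_) (+-identityʳ m) ⟩
        m + m                 ≤⟨ ⌊n/2⌋+⌊n/2⌋≤n n ⟩
        n                     ≡⟨ weight-map-not w ⟨
        b + a                 ∎))
        where
        open ≤-Reasoning
        a = weight w
        b = weight (Vec.map not w)
        rearrange : ∀ a t → a + 2 * t + a ≡ 2 * (a + t)
        rearrange = solve-∀

      highTail-far : ∀ w → T (highTail w) → 2 * t ≤ gap w
      highTail-far w high = subst (2 * t ≤_) (∣-∣-comm b a) (+≤⇒≤∣-∣ {b} {a} (+-cancelʳ-≤ a (b + 2 * t) a (begin
        b + 2 * t + a         ≡⟨ rearrange₁ b t a ⟩
        b + a + 2 * t         ≡⟨ cong (_+ 2 * t) (weight-map-not w) ⟩
        n + 2 * t             ≤⟨ +-monoˡ-≤ (2 * t) (n≤1+⌊n/2⌋+⌊n/2⌋ n) ⟩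
        suc (m + m) + 2 * t   ≤⟨ m≤m+n _ 3 ⟩
        suc (m + m) + 2 * t + 3 ≡⟨ rearrange₂ m t ⟩
        suc hi + suc hi       ≤⟨ +-mono-≤ (<ᵇ⇒< hi a high) (<ᵇ⇒< hi a high) ⟩
        a + a                 ∎)))
        where
        open ≤-Reasoning
        a = weight w
        b = weight (Vec.map not w)
        rearrange₁ : ∀ b t a → b + 2 * t + a ≡ b + a + 2 * t
        rearrange₁ = solve-∀
        rearrange₂ : ∀ m t → suc (m + m) + 2 * t + 3 ≡ suc (suc m + t) + suc (suc m + t)
        rearrange₂ = solve-∀

      lowWindow highWindow : ℕ
      lowWindow = sumBelow t (λ i → layerSize n (lo + i))
      highWindow = sumBelow (suc t) (λ i → layerSize n (hi ∸ i))

      lowWindow-mass : 2 ^ n ≤ 8 * lowWindow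
      lowWindow-mass = window-mass upper lowWindow lowTails covered (HalfMasses.upperHalf-mass n) (tail-mass lowTail lowTail-far)
        where
        atVertex : ∀ w → 1 ≤ ⟦ not (lowerHalf w) ⟧ + lowCount w + ⟦ lowTail w ⟧
        atVertex w with weight w ≤ᵇ m | proof (weight w ≤? m)
        ... | false | _ = s≤s z≤n
        ... | true | ofʸ w≤m with weight w + t ≤ᵇ m | proof (weight w + t ≤? m)
        ...   | true | _ = m≤n+m 1 _
        ...   | false | ofⁿ w+t≰m = ≤-trans inWindow (m≤m+n _ _)
          where
          lo≤w : lo ≤ weight w
          lo≤w = m≤n+o⇒m∸n≤o (suc m) t (≤-trans (≰⇒> w+t≰m) (≤-reflexive (+-comm (weight w) t)))
          offset<t : weight w ∸ lo < t
          offset<t = +-cancelˡ-< lo (weight w ∸ lo) t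
            (≤-trans (s≤s (≤-reflexive (m+[n∸m]≡n lo≤w))) (≤-trans (s≤s w≤m) (≤-reflexive (sym lo+t≡1+m))))
          inWindow : 1 ≤ lowCount w
          inWindow = sumBelow-≟-present t (lo +_) (weight w) (weight w ∸ lo) offset<t (sym (m+[n∸m]≡n lo≤w))
        upper = sumCube n (λ w → ⟦ not (lowerHalf w) ⟧)
        lowTails = sumCube n (λ w → ⟦ lowTail w ⟧)
        covered : 2 ^ n ≤ upper + lowWindow + lowTails
        covered = begin
          2 ^ n                                                             ≤⟨ 2^n≤sumCube n _ atVertex ⟩
          sumCube n (λ w → ⟦ not (lowerHalf w) ⟧ + lowCount w + ⟦ lowTail w ⟧) ≡⟨ sumCube-+₃ n _ _ _ ⟩
          upper + sumCube n lowCount + lowTails                             ≡⟨ cong (λ x → upper + x + lowTails) (sumBelow-sumCube t n (λ i → layer (lo + i))) ⟨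
          upper + lowWindow + lowTails                                      ∎
          where open ≤-Reasoning

      highWindow-mass : 2 ^ n ≤ 8 * highWindow
      highWindow-mass = window-mass lower highWindow highTails covered (HalfMasses.lowerHalf-mass n 1≤m) (tail-mass highTail highTail-far)
        where
        atVertex : ∀ w → 1 ≤ ⟦ lowerHalf w ⟧ + highCount w + ⟦ highTail w ⟧
        atVertex w with weight w ≤ᵇ m | proof (weight w ≤? m)
        ... | true | _ = s≤s z≤n
        ... | false | ofⁿ w≰m with hi <ᵇ weight w | proof (hi <? weight w)
        ...   | true | _ = m≤n+m 1 _
        ...   | false | ofⁿ hi≮w = ≤-trans inWindow (m≤m+n _ _)
          where
          offset<1+t : hi ∸ weight w < suc t
          offset<1+t = s≤s (≤-trans (∸-monoʳ-≤ hi (≰⇒> w≰m)) (≤-reflexive (trans (cong (_∸ suc m) (+-comm (suc m) t)) (m+n∸n≡m t (suc m)))))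
          inWindow : 1 ≤ highCount w
          inWindow = sumBelow-≟-present (suc t) (hi ∸_) (weight w) (hi ∸ weight w) offset<1+t (sym (m∸[m∸n]≡n (≮⇒≥ hi≮w)))
        lower = sumCube n (λ w → ⟦ lowerHalf w ⟧)
        highTails = sumCube n (λ w → ⟦ highTail w ⟧)
        covered : 2 ^ n ≤ lower + highWindow + highTails
        covered = begin
          2 ^ n                                                         ≤⟨ 2^n≤sumCube n _ atVertex ⟩
          sumCube n (λ w → ⟦ lowerHalf w ⟧ + highCount w + ⟦ highTail w ⟧) ≡⟨ sumCube-+₃ n _ _ _ ⟩
          lower + sumCube n highCount + highTails                       ≡⟨ cong (λ x → lower + x + highTails) (sumBelow-sumCube (suc t) n (λ i → layer (hi ∸ i))) ⟨
          lower + highWindow + highTails                                ∎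
          where open ≤-Reasoning

      slow-growth : ∀ i (f : ℕ → ℕ) {c α} → (∀ j → j < suc i → f j ≤ c) → k * suc i ≤ α → k * sumBelow (suc i) f ≤ c * α
      slow-growth i f {c} {α} f≤c k[1+i]≤α = begin
        k * sumBelow (suc i) f    ≤⟨ *-monoʳ-≤ k (sumBelow-≤-* (suc i) f≤c) ⟩
        k * (suc i * c)           ≡⟨ *-assoc k (suc i) c ⟨
        k * suc i * c             ≤⟨ *-monoˡ-≤ c k[1+i]≤α ⟩
        α * c                     ≡⟨ *-comm α c ⟩
        c * α                     ∎
        where open ≤-Reasoning

      lo+t≡hi∸t : lo + t ≡ hi ∸ t
      lo+t≡hi∸t = trans lo+t≡1+m (sym hi∸t≡1+m)

      lo+i≤n : ∀ {i} → i ≤ t → lo + i ≤ n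
      lo+i≤n i≤t = ≤-trans (+-monoʳ-≤ lo i≤t) (≤-trans (≤-reflexive lo+t≡1+m) (≤-trans (m≤m+n (suc m) t) hi≤n))

      hi∸[1+i]≡ : ∀ {i} → i < t → suc (hi ∸ suc i) ≡ hi ∸ i
      hi∸[1+i]≡ {i} i<t = sym (+-∸-assoc 1 (≤-trans i<t (m≤n+m t (suc m))))

      lowCount≤1 : ∀ w → lowCount w ≤ 1
      lowCount≤1 w = sumBelow-≟-≤1 t (lo +_) (weight w) (λ i j _ _ → +-cancelˡ-≡ lo i j)

      highCount≤1 : ∀ w → highCount w ≤ 1
      highCount≤1 w = sumBelow-≟-≤1 (suc t) (hi ∸_) (weight w)
        (λ i j i≤t j≤t → ∸-cancelˡ-≡ (≤-trans (≤-pred i≤t) (m≤n+m t (suc m))) (≤-trans (≤-pred j≤t) (m≤n+m t (suc m))))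

      lowCount-upper : ∀ w → m < weight w → lowCount w ≡ 0
      lowCount-upper w m<w = sumBelow-≟-absent t (lo +_) (weight w) (λ i i<t w≡lo+i → <⇒≱ m<w (≤-trans (≤-reflexive w≡lo+i) (lo+i≤m i<t)))

      highCount-lower : ∀ w → weight w ≤ m → highCount w ≡ 0
      highCount-lower w w≤m = sumBelow-≟-absent (suc t) (hi ∸_) (weight w)
        (λ i i≤t w≡hi∸i → <⇒≱ (1+m≤hi∸i (≤-pred i≤t)) (≤-trans (≤-reflexive (sym w≡hi∸i)) w≤m))

      lowCount+highCount≤1 : ∀ w → lowCount w + highCount w ≤ 1
      lowCount+highCount≤1 w with weight w ≤? m
      ... | yes w≤m = subst (λ h → lowCount w + h ≤ 1) (sym (highCount-lower w w≤m))
                            (≤-trans (≤-reflexive (+-identityʳ _)) (lowCount≤1 w))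
      ... | no w≰m = subst (λ l → l + highCount w ≤ 1) (sym (lowCount-upper w (≰⇒> w≰m))) (highCount≤1 w)

      sumBelow-layer-* : ∀ s (a : ℕ → ℕ) (h : Vec Bool n → ℕ) →
        sumBelow s (λ i → sumCube n (λ w → layer (a i) w * h w)) ≡ sumCube n (λ w → sumBelow s (λ i → layer (a i) w) * h w)
      sumBelow-layer-* s a h =
        trans (sumBelow-sumCube s n (λ i w → layer (a i) w * h w)) (sumCube-cong n (λ w → sumBelow-*ʳ s (λ i → layer (a i) w) (h w)))

    module _ (g : Vec Bool n → Bool) where
      open LayerCounts g

      private
        lowMisses lowCut highMisses highCut : ℕ
        lowMisses = sumBelow t (λ i → misses true (lo + i))
        lowCut = sumBelow t (λ i → cut (lo + i))
        highMisses = sumBelow (suc t) (λ i → misses false (hi ∸ i))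
        highCut = sumBelow t (λ i → cut (hi ∸ suc i))

        low-misses-step : ∀ i → i < t → misses true (lo + suc i) * suc (lo + i) ≤ cut (lo + i) + misses true (lo + i) * (n ∸ (lo + i))
        low-misses-step i _ = subst (λ a → misses true a * suc (lo + i) ≤ cut (lo + i) + misses true (lo + i) * (n ∸ (lo + i)))
                                    (sym (+-suc lo i)) (misses-up true (lo + i))

        low-layer-step : ∀ i → i < t → layerSize n (lo + i) * (n ∸ (lo + i)) ≡ layerSize n (lo + suc i) * suc (lo + i)
        low-layer-step i _ = trans (layerSize-step n (lo + i)) (cong (λ a → layerSize n a * suc (lo + i)) (sym (+-suc lo i)))

        low-slow : ∀ i → i < t → k * sumBelow (suc i) (λ j → layerSize n (lo + j)) ≤ layerSize n (lo + i) * (n ∸ (lo + i))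
        low-slow i i<t = slow-growth i _
          (λ j j≤i → layerSize-increasing n (+-monoʳ-≤ lo (≤-pred j≤i)) (lo+i≤m i<t))
          (≤-trans (k*[1+i]≤m i<t) (≤-trans m≤n∸m (∸-monoʳ-≤ n (lo+i≤m i<t))))

        high-misses-step : ∀ i → i < t →
          misses false (hi ∸ suc i) * (n ∸ (hi ∸ suc i)) ≤ cut (hi ∸ suc i) + misses false (hi ∸ i) * (hi ∸ i)
        high-misses-step i i<t = subst (λ a → misses false (hi ∸ suc i) * (n ∸ (hi ∸ suc i)) ≤ cut (hi ∸ suc i) + misses false a * a)
                                       (hi∸[1+i]≡ i<t) (misses-down false (hi ∸ suc i))

        high-layer-step : ∀ i → i < t → layerSize n (hi ∸ i) * (hi ∸ i) ≡ layerSize n (hi ∸ suc i) * (n ∸ (hi ∸ suc i))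
        high-layer-step i i<t = subst (λ a → layerSize n a * a ≡ layerSize n (hi ∸ suc i) * (n ∸ (hi ∸ suc i)))
                                      (hi∸[1+i]≡ i<t) (sym (layerSize-step n (hi ∸ suc i)))

        high-slow : ∀ i → i < t → k * sumBelow (suc i) (λ j → layerSize n (hi ∸ j)) ≤ layerSize n (hi ∸ i) * (hi ∸ i)
        high-slow i i<t = slow-growth i _
          (λ j j≤i → layerSize-decreasing n (≤-trans (n≤1+n m) (1+m≤hi∸i (<⇒≤ i<t))) (∸-monoʳ-≤ hi (≤-pred j≤i)))
          (≤-trans (k*[1+i]≤m i<t) (≤-trans (n≤1+n m) (1+m≤hi∸i (<⇒≤ i<t))))

        module Low = DensityPropagation k t
          (λ i → layerSize n (lo + i)) (λ i → misses true (lo + i)) (λ i → cut (lo + i))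
          (λ i → n ∸ (lo + i)) (λ i → suc (lo + i))
          low-misses-step low-layer-step low-slow (λ i i≤t → layerSize-pos n (lo + i) (lo+i≤n i≤t))

        module High = DensityPropagation k t
          (λ i → layerSize n (hi ∸ i)) (λ i → misses false (hi ∸ i)) (λ i → cut (hi ∸ suc i))
          (λ i → hi ∸ i) (λ i → n ∸ (hi ∸ suc i))
          high-misses-step high-layer-step high-slow (λ i _ → layerSize-pos n (hi ∸ i) (≤-trans (m∸n≤m hi i) hi≤n))

        c X Y : ℕ
        c = layerSize n (hi ∸ t)
        X = misses false (hi ∸ t)
        Y = misses true (hi ∸ t)

        low-density : k * lowWindow * Y ≤ c * (k * lowMisses + lowCut)
        low-density = subst (λ a → k * lowWindow * misses true a ≤ layerSize n a * (k * lowMisses + lowCut)) lo+t≡hi∸t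
                            (Low.density-bound t ≤-refl)

        high-density : k * sumBelow t (λ i → layerSize n (hi ∸ i)) * X ≤ c * (k * sumBelow t (λ i → misses false (hi ∸ i)) + highCut)
        high-density = High.density-bound t ≤-refl

        windows-bound : k * 2 ^ n ≤ 8 * (k * (lowMisses + highMisses) + (lowCut + highCut))
        windows-bound = *-cancelˡ-≤ c {{>-nonZero (layerSize-pos n (hi ∸ t) (≤-trans (m∸n≤m hi t) hi≤n))}} (begin
          c * (k * 2 ^ n)
            ≡⟨ cong (_* (k * 2 ^ n)) (misses-true+false (hi ∸ t)) ⟨
          (Y + X) * (k * 2 ^ n)
            ≡⟨ rearrange₁ Y X k (2 ^ n) ⟩
          k * 2 ^ n * Y + k * 2 ^ n * X
            ≤⟨ +-mono-≤ (*-monoˡ-≤ Y (*-monoʳ-≤ k lowWindow-mass)) (*-monoˡ-≤ X (*-monoʳ-≤ k highWindow-mass)) ⟩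
          k * (8 * lowWindow) * Y + k * (8 * (SH + c)) * X
            ≡⟨ rearrange₂ k lowWindow Y SH c X ⟩
          8 * (k * lowWindow * Y + k * SH * X + c * (k * X))
            ≤⟨ *-monoʳ-≤ 8 (+-monoˡ-≤ (c * (k * X)) (+-mono-≤ low-density high-density)) ⟩
          8 * (c * (k * lowMisses + lowCut) + c * (k * HM + highCut) + c * (k * X))
            ≡⟨ rearrange₃ c k lowMisses lowCut HM highCut X ⟩
          c * (8 * (k * (lowMisses + (HM + X)) + (lowCut + highCut)))
            ∎)
          where
          open ≤-Reasoning
          SH = sumBelow t (λ i → layerSize n (hi ∸ i))
          HM = sumBelow t (λ i → misses false (hi ∸ i))
          rearrange₁ : ∀ y x k p → (y + x) * (k * p) ≡ k * p * y + k * p * x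
          rearrange₁ = solve-∀
          rearrange₂ : ∀ k L y S c x → k * (8 * L) * y + k * (8 * (S + c)) * x ≡ 8 * (k * L * y + k * S * x + c * (k * x))
          rearrange₂ = solve-∀
          rearrange₃ : ∀ c k lm lc hm hc x →
            8 * (c * (k * lm + lc) + c * (k * hm + hc) + c * (k * x)) ≡ c * (8 * (k * (lm + (hm + x)) + (lc + hc)))
          rearrange₃ = solve-∀

        misses-bound : lowMisses + highMisses ≤ distance g lowerHalf
        misses-bound = begin
          lowMisses + highMisses
            ≡⟨ cong₂ _+_ (sumBelow-layer-* t (lo +_) (λ w → ⟦ not (g w) ⟧)) (sumBelow-layer-* (suc t) (hi ∸_) (λ w → ⟦ g w ⟧)) ⟩
          sumCube n (λ w → lowCount w * ⟦ not (g w) ⟧) + sumCube n (λ w → highCount w * ⟦ g w ⟧)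
            ≡⟨ sumCube-+ n _ _ ⟨
          sumCube n (λ w → lowCount w * ⟦ not (g w) ⟧ + highCount w * ⟦ g w ⟧)
            ≤⟨ sumCube-mono n atVertex ⟩
          distance g lowerHalf
            ∎
          where
          open ≤-Reasoning
          atVertex : ∀ w → lowCount w * ⟦ not (g w) ⟧ + highCount w * ⟦ g w ⟧ ≤ ⟦ g w xor lowerHalf w ⟧
          atVertex w with weight w ≤ᵇ m | proof (weight w ≤? m)
          ... | true | ofʸ w≤m = begin
            lowCount w * ⟦ not (g w) ⟧ + highCount w * ⟦ g w ⟧  ≡⟨ cong (λ h → lowCount w * ⟦ not (g w) ⟧ + h * ⟦ g w ⟧) (highCount-lower w w≤m) ⟩
            lowCount w * ⟦ not (g w) ⟧ + 0                      ≤⟨ ≤-reflexive (+-identityʳ _) ⟩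
            lowCount w * ⟦ not (g w) ⟧                          ≤⟨ *-≤1 _ (lowCount≤1 w) ⟩
            ⟦ not (g w) ⟧                                       ≡⟨ cong ⟦_⟧ (xor-comm true (g w)) ⟩
            ⟦ g w xor true ⟧                                    ∎
          ... | false | ofⁿ w≰m = begin
            lowCount w * ⟦ not (g w) ⟧ + highCount w * ⟦ g w ⟧  ≡⟨ cong (λ l → l * ⟦ not (g w) ⟧ + highCount w * ⟦ g w ⟧) (lowCount-upper w (≰⇒> w≰m)) ⟩
            highCount w * ⟦ g w ⟧                               ≤⟨ *-≤1 _ (highCount≤1 w) ⟩
            ⟦ g w ⟧                                             ≡⟨ cong ⟦_⟧ (xor-identityʳ (g w)) ⟨
            ⟦ g w xor false ⟧                                   ∎

        cut-bound : lowCut + highCut ≤ boundary g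
        cut-bound = begin
          lowCut + highCut
            ≡⟨ cong₂ _+_ (sumBelow-layer-* t (lo +_) boundaryAt) (sumBelow-layer-* t (λ i → hi ∸ suc i) boundaryAt) ⟩
          sumCube n (λ w → lowCount w * boundaryAt w) + sumCube n (λ w → shiftedCount w * boundaryAt w)
            ≡⟨ sumCube-+ n _ _ ⟨
          sumCube n (λ w → lowCount w * boundaryAt w + shiftedCount w * boundaryAt w)
            ≤⟨ sumCube-mono n atVertex ⟩
          boundary g
            ∎
          where
          open ≤-Reasoning
          shiftedCount : Vec Bool n → ℕ
          shiftedCount w = sumBelow t (λ i → layer (hi ∸ suc i) w)
          atVertex : ∀ w → lowCount w * boundaryAt w + shiftedCount w * boundaryAt w ≤ boundaryAt w
          atVertex w = begin
            lowCount w * boundaryAt w + shiftedCount w * boundaryAt w  ≡⟨ *-distribʳ-+ (boundaryAt w) (lowCount w) _ ⟨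
            (lowCount w + shiftedCount w) * boundaryAt w               ≤⟨ *-≤1 _ (≤-trans (+-monoʳ-≤ (lowCount w) shifted≤) (lowCount+highCount≤1 w)) ⟩
            boundaryAt w                                               ∎
            where
            shifted≤ : shiftedCount w ≤ highCount w
            shifted≤ = ≤-trans (m≤n+m _ _) (≤-reflexive (sym (sumBelow-suc t (λ i → layer (hi ∸ i) w))))

      isoperimetry : k * 2 ^ n ≤ 8 * (k * distance g lowerHalf + boundary g)
      isoperimetry = ≤-trans windows-bound (*-monoʳ-≤ 8 (+-mono-≤ (*-monoʳ-≤ k misses-bound) cut-bound))

  lowerHalf-isoperimetry : ∀ n k → 1 ≤ k → 128 * (k * k) ≤ n → (g : Vec Bool n → Bool) →
    k * 2 ^ n ≤ 8 * (k * distance g lowerHalf + boundary g)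
  lowerHalf-isoperimetry n k@(suc _) 1≤k 128k²≤n = Windows.isoperimetry n k t 1≤k 1≤t 2kt≤m 2n≤t²
    where
    m = ⌊ n /2⌋
    -- the widest windows with 2kt ≤ m; since n ≥ 128k² they are still wide enough that t² ≥ 2n
    t = m / (2 * k)

    k≤k² : k ≤ k * k
    k≤k² = ≤-trans (≤-reflexive (sym (*-identityʳ k))) (*-monoʳ-≤ k 1≤k)

    2k≤m : 2 * k ≤ m
    2k≤m = *-cancelˡ-≤ 2 (+-cancelʳ-≤ 1 (2 * (2 * k)) (2 * m) (begin
      2 * (2 * k) + 1        ≤⟨ +-mono-≤ (*-monoʳ-≤ 2 (*-monoʳ-≤ 2 k≤k²)) (*-mono-≤ 1≤k 1≤k) ⟩
      2 * (2 * (k * k)) + k * k ≡⟨ rearrange₁ (k * k) ⟩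
      5 * (k * k)            ≤⟨ *-monoˡ-≤ (k * k) (m≤m+n 5 123) ⟩
      128 * (k * k)          ≤⟨ 128k²≤n ⟩
      n                      ≤⟨ n≤1+⌊n/2⌋+⌊n/2⌋ n ⟩
      suc (m + m)            ≡⟨ rearrange₂ m ⟩
      2 * m + 1              ∎))
      where
      open ≤-Reasoning
      rearrange₁ : ∀ x → 2 * (2 * x) + x ≡ 5 * x
      rearrange₁ = solve-∀
      rearrange₂ : ∀ m → suc (m + m) ≡ 2 * m + 1
      rearrange₂ = solve-∀

    1≤t : 1 ≤ t
    1≤t = m≥n⇒m/n>0 2k≤m

    2kt≤m : 2 * k * t ≤ m
    2kt≤m = ≤-trans (≤-reflexive (*-comm (2 * k) t)) (m/n*n≤m m (2 * k))

    2n≤t² : 2 * n ≤ t * t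
    2n≤t² = *-cancelˡ-≤ 64 (*-cancelˡ-≤ (k * k) (begin
      k * k * (64 * (2 * n))            ≡⟨ rearrange₁ k n ⟩
      n * (128 * (k * k))               ≤⟨ *-monoʳ-≤ n 128k²≤n ⟩
      n * n                             ≤⟨ *-mono-≤ n≤4k[1+t] n≤4k[1+t] ⟩
      4 * k * suc t * (4 * k * suc t)   ≡⟨ rearrange₂ k t ⟩
      k * k * (16 * (suc t * suc t))    ≤⟨ *-monoʳ-≤ (k * k) (*-monoʳ-≤ 16 [1+t]²≤4t²) ⟩
      k * k * (16 * (4 * (t * t)))      ≡⟨ rearrange₃ k t ⟩
      k * k * (64 * (t * t))            ∎))
      where
      open ≤-Reasoning
      rearrange₁ : ∀ k n → k * k * (64 * (2 * n)) ≡ n * (128 * (k * k))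
      rearrange₁ = solve-∀
      rearrange₂ : ∀ k t → 4 * k * suc t * (4 * k * suc t) ≡ k * k * (16 * (suc t * suc t))
      rearrange₂ = solve-∀
      rearrange₃ : ∀ k t → k * k * (16 * (4 * (t * t))) ≡ k * k * (64 * (t * t))
      rearrange₃ = solve-∀
      [1+t]²≤4t² : suc t * suc t ≤ 4 * (t * t)
      [1+t]²≤4t² = ≤-trans (*-mono-≤ (+-monoˡ-≤ t 1≤t) (+-monoˡ-≤ t 1≤t)) (≤-reflexive (square t))
        where
        square : ∀ t → (t + t) * (t + t) ≡ 4 * (t * t)
        square = solve-∀
      n≤4k[1+t] : n ≤ 4 * k * suc t
      n≤4k[1+t] = begin
        n                        ≤⟨ n≤1+⌊n/2⌋+⌊n/2⌋ n ⟩
        suc (m + m)              ≤⟨ s≤s (+-monoʳ-≤ m (n≤1+n m)) ⟩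
        suc m + suc m            ≤⟨ +-mono-≤ (m<[1+m/n]*n m (2 * k)) (m<[1+m/n]*n m (2 * k)) ⟩
        suc t * (2 * k) + suc t * (2 * k) ≡⟨ rearrange (suc t) k ⟩
        4 * k * suc t            ∎
        where
        rearrange : ∀ s k → s * (2 * k) + s * (2 * k) ≡ 4 * k * s
        rearrange = solve-∀

  -- The instance Δ[k, k + n] on Q_k × Q_n

  sumList : ∀ {A : Set} → (A → ℕ) → List A → ℕ
  sumList f [] = 0
  sumList f (x ∷ xs) = f x + sumList f xs

  sumList-++ : ∀ {A : Set} (f : A → ℕ) xs ys → sumList f (xs List.++ ys) ≡ sumList f xs + sumList f ys
  sumList-++ f [] ys = refl
  sumList-++ f (x ∷ xs) ys = trans (cong (f x +_) (sumList-++ f xs ys)) (sym (+-assoc (f x) _ _))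

  sumList-cong : ∀ {A : Set} {f g : A → ℕ} → (∀ x → f x ≡ g x) → ∀ xs → sumList f xs ≡ sumList g xs
  sumList-cong f≗g [] = refl
  sumList-cong f≗g (x ∷ xs) = cong₂ _+_ (f≗g x) (sumList-cong f≗g xs)

  sumList-concatMap : ∀ {A B : Set} (f : B → ℕ) (h : A → List B) xs →
    sumList f (concatMap h xs) ≡ sumList (λ x → sumList f (h x)) xs
  sumList-concatMap f h [] = refl
  sumList-concatMap f h (x ∷ xs) = trans (sumList-++ f (h x) _) (cong (sumList f (h x) +_) (sumList-concatMap f h xs))

  sumList-map : ∀ {A B : Set} (f : B → ℕ) (h : A → B) xs → sumList f (List.map h xs) ≡ sumList (f ∘ h) xs
  sumList-map f h [] = refl
  sumList-map f h (x ∷ xs) = cong (f (h x) +_) (sumList-map f h xs)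

  sumList-filterᵇ : ∀ {A : Set} (f : A → ℕ) (p : A → Bool) xs →
    sumList f (filterᵇ p xs) ≡ sumList (λ x → ⟦ p x ⟧ * f x) xs
  sumList-filterᵇ f p [] = refl
  sumList-filterᵇ f p (x ∷ xs) with p x
  ... | true = cong₂ _+_ (sym (+-identityʳ (f x))) (sumList-filterᵇ f p xs)
  ... | false = sumList-filterᵇ f p xs

  length≡sumList : ∀ {A : Set} (xs : List A) → length xs ≡ sumList (λ _ → 1) xs
  length≡sumList [] = refl
  length≡sumList (x ∷ xs) = cong suc (length≡sumList xs)

  length-filterᵇ : ∀ {A : Set} (p : A → Bool) xs → length (filterᵇ p xs) ≡ sumList (λ x → ⟦ p x ⟧) xs
  length-filterᵇ p xs =
    trans (length≡sumList (filterᵇ p xs)) (trans (sumList-filterᵇ _ p xs) (sumList-cong (λ x → *-identityʳ ⟦ p x ⟧) xs))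

  sumList-tabulate : ∀ {A : Set} n (f : A → ℕ) (g : Fin n → A) → sumList f (List.tabulate g) ≡ sumFin n (f ∘ g)
  sumList-tabulate zero f g = refl
  sumList-tabulate (suc n) f g = cong (f (g zero) +_) (sumList-tabulate n f (g ∘ suc))

  sumList-allFin : ∀ n (f : Fin n → ℕ) → sumList f (allFin n) ≡ sumFin n f
  sumList-allFin n f = sumList-tabulate n f (λ i → i)

  sumList-allVertices : ∀ n (f : Vec Bool n → ℕ) → sumList f (allVertices n) ≡ sumCube n f
  sumList-allVertices zero f = +-identityʳ (f [])
  sumList-allVertices (suc n) f =
    trans (sumList-concatMap f _ (allVertices n))
          (trans (sumList-cong (λ v → cong (f (false ∷ v) +_) (+-identityʳ (f (true ∷ v)))) (allVertices n))
                 (sumList-allVertices n _))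

  sumList-allEdges : ∀ d (f : Edge d → ℕ) → sumList f (allEdges d) ≡ sumEdges d (λ v i → f (edge v i))
  sumList-allEdges d f =
    trans (sumList-concatMap f _ (allVertices d))
          (trans (sumList-cong atVertex (allVertices d)) (sumList-allVertices d _))
    where
    atVertex : ∀ v → sumList f (List.map (edge v) (filterᵇ (λ i → not (lookup v i)) (allFin d)))
                   ≡ sumFin d (λ i → ⟦ not (lookup v i) ⟧ * f (edge v i))
    atVertex v = trans (sumList-map f (edge v) (filterᵇ notᵥ (allFin d)))
                       (trans (sumList-filterᵇ (f ∘ edge v) notᵥ (allFin d)) (sumList-allFin d _))
      where
      notᵥ : Fin d → Bool
      notᵥ i = not (lookup v i)

  length-allEdges : ∀ d → 2 * length (allEdges d) ≡ d * 2 ^ d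
  length-allEdges d = trans (cong (2 *_) (trans (length≡sumList (allEdges d)) (sumList-allEdges d _))) (edgeCount d)

  unsatCount≡sumEdges : ∀ {d} (I : Instance d) σ →
    unsatCount I σ ≡ sumEdges d (λ v i → ⟦ not (satisfies I σ (edge v i)) ⟧)
  unsatCount≡sumEdges {d} I σ = trans (length-filterᵇ _ (allEdges d)) (sumList-allEdges d _)

  flipAt-++ˡ : ∀ {k n} (x : Vec Bool k) (w : Vec Bool n) i → flipAt (x ++ w) (i ↑ˡ n) ≡ flipAt x i ++ w
  flipAt-++ˡ (b ∷ x) w zero = refl
  flipAt-++ˡ (b ∷ x) w (suc i) = cong (b ∷_) (flipAt-++ˡ x w i)

  flipAt-++ʳ : ∀ {k n} (x : Vec Bool k) (w : Vec Bool n) j → flipAt (x ++ w) (k ↑ʳ j) ≡ x ++ flipAt w j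
  flipAt-++ʳ [] w j = refl
  flipAt-++ʳ (b ∷ x) w j = cong (b ∷_) (flipAt-++ʳ x w j)

  sumEdges-++ : ∀ k n (F : Vec Bool (k + n) → Fin (k + n) → ℕ) →
    sumEdges (k + n) F ≡ sumEdges k (λ x i → sumCube n (λ w → F (x ++ w) (i ↑ˡ n)))
                       + sumCube k (λ x → sumEdges n (λ w j → F (x ++ w) (k ↑ʳ j)))
  sumEdges-++ k n F = begin
    sumEdges (k + n) F
      ≡⟨ sumCube-++ k n _ ⟩
    sumCube k (λ x → sumCube n (λ w → sumFin (k + n) (λ j → ⟦ not (lookup (x ++ w) j) ⟧ * F (x ++ w) j)))
      ≡⟨ sumCube-cong k (λ x → sumCube-cong n (λ w → trans (sumFin-↑ k n _) (cong₂ _+_ (fiberAt x w) (crossAt x w)))) ⟩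
    sumCube k (λ x → sumCube n (λ w → fiber x w + cross x w))
      ≡⟨ trans (sumCube-cong k (λ x → sumCube-+ n _ _)) (sumCube-+ k _ _) ⟩
    sumCube k (λ x → sumCube n (fiber x)) + sumCube k (λ x → sumCube n (cross x))
      ≡⟨ cong (_+ sumCube k (λ x → sumCube n (cross x))) (sumCube-cong k (λ x → trans (sym (sumFin-sumCube k n _))
           (sumFin-cong k (λ i → sumCube-*ˡ n ⟦ not (lookup x i) ⟧ (λ w → F (x ++ w) (i ↑ˡ n)))))) ⟩
    sumEdges k (λ x i → sumCube n (λ w → F (x ++ w) (i ↑ˡ n))) + sumCube k (λ x → sumEdges n (λ w j → F (x ++ w) (k ↑ʳ j)))
      ∎
    where
    open ≡-Reasoning
    fiber : Vec Bool k → Vec Bool n → ℕ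
    fiber x w = sumFin k (λ i → ⟦ not (lookup x i) ⟧ * F (x ++ w) (i ↑ˡ n))
    cross : Vec Bool k → Vec Bool n → ℕ
    cross x w = sumFin n (λ j → ⟦ not (lookup w j) ⟧ * F (x ++ w) (k ↑ʳ j))
    fiberAt : ∀ x w → sumFin k (λ i → ⟦ not (lookup (x ++ w) (i ↑ˡ n)) ⟧ * F (x ++ w) (i ↑ˡ n)) ≡ fiber x w
    fiberAt x w = sumFin-cong k (λ i → cong (λ b → ⟦ not b ⟧ * F (x ++ w) (i ↑ˡ n)) (lookup-++ˡ x w i))
    crossAt : ∀ x w → sumFin n (λ j → ⟦ not (lookup (x ++ w) (k ↑ʳ j)) ⟧ * F (x ++ w) (k ↑ʳ j)) ≡ cross x w
    crossAt x w = sumFin-cong n (λ j → cong (λ b → ⟦ not b ⟧ * F (x ++ w) (k ↑ʳ j)) (lookup-++ʳ x w j))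

  H-++ : ∀ k {n} (x : Vec Bool k) (w : Vec Bool n) → H k (x ++ w) ≡ weight w
  H-++ k {n} x w = begin
    H k (x ++ w)
      ≡⟨ trans (length-filterᵇ inTail (allFin (k + n))) (sumList-allFin (k + n) _) ⟩
    sumFin (k + n) (λ j → ⟦ inTail j ⟧)
      ≡⟨ sumFin-↑ k n _ ⟩
    sumFin k (λ i → ⟦ inTail (i ↑ˡ n) ⟧) + sumFin n (λ j → ⟦ inTail (k ↑ʳ j) ⟧)
      ≡⟨ cong₂ _+_ (trans (sumFin-cong k head) (sumFin-const k 0)) (sumFin-cong n tail) ⟩
    k * 0 + sumFin n (λ j → ⟦ lookup w j ⟧)
      ≡⟨ cong₂ _+_ (*-zeroʳ k) (sym (weight≡sumFin w)) ⟩
    weight w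
      ∎
    where
    open ≡-Reasoning
    inTail : Fin (k + n) → Bool
    inTail j = (k <ᵇ suc (toℕ j)) ∧ lookup (x ++ w) j
    head : ∀ i → ⟦ inTail (i ↑ˡ n) ⟧ ≡ 0
    head i rewrite toℕ-↑ˡ i n | <ᵇ-false {k} {suc (toℕ i)} (λ k<1+i → <⇒≱ (toℕ<n i) (≤-pred k<1+i)) = refl
    tail : ∀ j → ⟦ inTail (k ↑ʳ j) ⟧ ≡ ⟦ lookup w j ⟧
    tail j rewrite toℕ-↑ʳ k j | <ᵇ-true {k} {suc (k + toℕ j)} (s≤s (m≤m+n k (toℕ j))) | lookup-++ʳ x w j = refl

  lowerHalf-threshold : ∀ k n h → (if k + n <ᵇ 2 * h + k then false else true) ≡ does (h ≤? ⌊ n /2⌋)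
  lowerHalf-threshold k n h with h ≤ᵇ ⌊ n /2⌋ | proof (h ≤? ⌊ n /2⌋)
  ... | true | ofʸ h≤m = cong (if_then false else true) (<ᵇ-false (≤⇒≯ light))
    where
    light : 2 * h + k ≤ k + n
    light = begin
      2 * h + k               ≡⟨ +-comm (2 * h) k ⟩
      k + 2 * h               ≤⟨ +-monoʳ-≤ k (*-monoʳ-≤ 2 h≤m) ⟩
      k + 2 * ⌊ n /2⌋         ≤⟨ +-monoʳ-≤ k (≤-trans (≤-reflexive (cong (⌊ n /2⌋ +_) (+-identityʳ _))) (⌊n/2⌋+⌊n/2⌋≤n n)) ⟩
      k + n                   ∎
      where open ≤-Reasoning
  ... | false | ofⁿ h≰m = cong (if_then false else true) (<ᵇ-true heavy)
    where
    1+m+m<2h : suc (⌊ n /2⌋ + ⌊ n /2⌋) < 2 * h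
    1+m+m<2h = ≤-trans (s≤s (≤-reflexive (sym (+-suc ⌊ n /2⌋ ⌊ n /2⌋))))
                       (≤-trans (+-mono-≤ (≰⇒> h≰m) (≰⇒> h≰m)) (≤-reflexive (cong (h +_) (sym (+-identityʳ h)))))
    heavy : k + n < 2 * h + k
    heavy = begin-strict
      k + n                   ≤⟨ +-monoʳ-≤ k (n≤1+⌊n/2⌋+⌊n/2⌋ n) ⟩
      k + suc (⌊ n /2⌋ + ⌊ n /2⌋) <⟨ +-monoʳ-< k 1+m+m<2h ⟩
      k + 2 * h               ≡⟨ +-comm k (2 * h) ⟩
      2 * h + k               ∎
      where open ≤-Reasoning

  Δ-fiber : ∀ k n (x : Vec Bool k) (w : Vec Bool n) i → Δ k (k + n) (edge (x ++ w) (i ↑ˡ n)) ≡ lowerHalf w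
  Δ-fiber k n x w i
    rewrite toℕ-↑ˡ i n | <ᵇ-false {k} {suc (toℕ i)} (λ k<1+i → <⇒≱ (toℕ<n i) (≤-pred k<1+i)) | H-++ k x w
    = lowerHalf-threshold k n (weight w)

  Δ-cross : ∀ k n (x : Vec Bool k) (w : Vec Bool n) j → Δ k (k + n) (edge (x ++ w) (k ↑ʳ j)) ≡ false
  Δ-cross k n x w j rewrite toℕ-↑ʳ k j | <ᵇ-true {k} {suc (k + toℕ j)} (s≤s (m≤m+n k (toℕ j))) = refl

  not-satisfies : ∀ {d} (I : Instance d) σ e → not (satisfies I σ e) ≡ (σ (low e) xor σ (high e)) xor I e
  not-satisfies I σ e = not-≟ᵇ (σ (low e) xor σ (high e)) (I e)
    where
    not-≟ᵇ : ∀ a b → not (does (a ≟ᵇ b)) ≡ a xor b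
    not-≟ᵇ true true = refl
    not-≟ᵇ true false = refl
    not-≟ᵇ false true = refl
    not-≟ᵇ false false = refl

  boundary-xor : ∀ {n} (g h : Vec Bool n → Bool) → boundary (λ w → g w xor h w) ≤ boundary g + boundary h
  boundary-xor {n} g h = ≤-trans (sumEdges-mono n atEdge) (≤-reflexive (sumEdges-+ n _ _))
    where
    atEdge : ∀ w j → ⟦ (g w xor h w) xor (g (flipAt w j) xor h (flipAt w j)) ⟧
                   ≤ ⟦ g w xor g (flipAt w j) ⟧ + ⟦ h w xor h (flipAt w j) ⟧
    atEdge w j = subst (λ b → ⟦ b ⟧ ≤ ⟦ g w xor g w′ ⟧ + ⟦ h w xor h w′ ⟧) (sym (xor-interchange (g w) (h w) (g w′) (h w′)))
                       (⟦xor⟧-subadditive (g w xor g w′) (h w xor h w′))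
      where
      w′ = flipAt w j

  sumEdges-endpoints : ∀ k (f : Vec Bool k → ℕ) → sumEdges k (λ x i → f x + f (flipAt x i)) ≡ k * sumCube k f
  sumEdges-endpoints k f = begin
    sumEdges k (λ x i → f x + f (flipAt x i))
      ≡⟨ sumEdges-+ k _ _ ⟩
    sumEdges k (λ x _ → f x) + sumEdges k (λ x i → f (flipAt x i))
      ≡⟨ cong (sumEdges k (λ x _ → f x) +_) (sumEdges-byHigh k _) ⟩
    sumEdges k (λ x _ → f x) + sumCube k (λ x → sumFin k (λ i → ⟦ lookup x i ⟧ * f (flipAt (flipAt x i) i)))
      ≡⟨ sumCube-+ k _ _ ⟨
    sumCube k (λ x → sumFin k (λ i → ⟦ not (lookup x i) ⟧ * f x) + sumFin k (λ i → ⟦ lookup x i ⟧ * f (flipAt (flipAt x i) i)))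
      ≡⟨ sumCube-cong k atVertex ⟩
    sumCube k (λ x → k * f x)
      ≡⟨ sumCube-*ˡ k k f ⟩
    k * sumCube k f
      ∎
    where
    open ≡-Reasoning
    bothEnds : ∀ x i → ⟦ not (lookup x i) ⟧ * f x + ⟦ lookup x i ⟧ * f (flipAt (flipAt x i) i) ≡ f x
    bothEnds x i rewrite flipAt-involutive x i =
      trans (sym (*-distribʳ-+ (f x) ⟦ not (lookup x i) ⟧ _))
            (trans (cong (_* f x) (trans (+-comm ⟦ not (lookup x i) ⟧ _) (⟦⟧+⟦not⟧ (lookup x i)))) (*-identityˡ (f x)))
    atVertex : ∀ x → sumFin k (λ i → ⟦ not (lookup x i) ⟧ * f x) + sumFin k (λ i → ⟦ lookup x i ⟧ * f (flipAt (flipAt x i) i))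
                   ≡ k * f x
    atVertex x = trans (sym (sumFin-+ k _ _)) (trans (sumFin-cong k (bothEnds x)) (sumFin-const k (f x)))

  module _ (k n : ℕ) (σ : Assignment (k + n)) where

    slice : Vec Bool k → Vec Bool n → Bool
    slice x w = σ (x ++ w)

    fiberDiff : Vec Bool k → Fin k → Vec Bool n → Bool
    fiberDiff x i w = slice x w xor slice (flipAt x i) w

    unsatCount-Δ : unsatCount (Δ k (k + n)) σ ≡
      sumEdges k (λ x i → distance (fiberDiff x i) lowerHalf) + sumCube k (λ x → boundary (slice x))
    unsatCount-Δ =
      trans (unsatCount≡sumEdges (Δ k (k + n)) σ)
            (trans (sumEdges-++ k n _)
                   (cong₂ _+_ (sumEdges-cong k (λ x i → sumCube-cong n (λ w → cong ⟦_⟧ (fiberEdge x i w))))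
                              (sumCube-cong k (λ x → sumEdges-cong n (λ w j → cong ⟦_⟧ (crossEdge x w j))))))
      where
      fiberEdge : ∀ x i w → not (satisfies (Δ k (k + n)) σ (edge (x ++ w) (i ↑ˡ n))) ≡ fiberDiff x i w xor lowerHalf w
      fiberEdge x i w rewrite not-satisfies (Δ k (k + n)) σ (edge (x ++ w) (i ↑ˡ n)) | Δ-fiber k n x w i
                            | flipAt-++ˡ x w i = refl
      crossEdge : ∀ x w j → not (satisfies (Δ k (k + n)) σ (edge (x ++ w) (k ↑ʳ j))) ≡ slice x w xor slice x (flipAt w j)
      crossEdge x w j rewrite not-satisfies (Δ k (k + n)) σ (edge (x ++ w) (k ↑ʳ j)) | Δ-cross k n x w j
                            | flipAt-++ʳ x w j = xor-identityʳ _

    fiber-boundaries : sumEdges k (λ x i → boundary (fiberDiff x i)) ≤ k * sumCube k (λ x → boundary (slice x))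
    fiber-boundaries = ≤-trans (sumEdges-mono k (λ x i → boundary-xor (slice x) (slice (flipAt x i))))
                               (≤-reflexive (sumEdges-endpoints k (λ x → boundary (slice x))))

    unsatCount-Δ-bound : 1 ≤ k → 128 * (k * k) ≤ n → k * 2 ^ (k + n) ≤ 16 * unsatCount (Δ k (k + n)) σ
    unsatCount-Δ-bound 1≤k 128k²≤n = *-cancelˡ-≤ k {{>-nonZero 1≤k}} (begin
      k * (k * 2 ^ (k + n))
        ≡⟨ cong (λ p → k * (k * p)) (^-distribˡ-+-* 2 k n) ⟩
      k * (k * (2 ^ k * 2 ^ n))
        ≡⟨ rearrange₁ k (2 ^ k) (2 ^ n) ⟩
      k * 2 ^ k * (k * 2 ^ n)
        ≡⟨ cong (_* (k * 2 ^ n)) (edgeCount k) ⟨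
      2 * E * (k * 2 ^ n)
        ≡⟨ rearrange₂ E (k * 2 ^ n) ⟩
      2 * (k * 2 ^ n * E)
        ≤⟨ *-monoʳ-≤ 2 counted ⟩
      2 * (8 * (k * U))
        ≡⟨ rearrange₃ k U ⟩
      k * (16 * U)
        ∎)
      where
      open ≤-Reasoning
      E = sumEdges k (λ _ _ → 1)
      U = unsatCount (Δ k (k + n)) σ
      Fib = sumEdges k (λ x i → distance (fiberDiff x i) lowerHalf)
      Cross = sumCube k (λ x → boundary (slice x))
      FibBd = sumEdges k (λ x i → boundary (fiberDiff x i))
      rearrange₁ : ∀ k a b → k * (k * (a * b)) ≡ k * a * (k * b)
      rearrange₁ = solve-∀
      rearrange₂ : ∀ e p → 2 * e * p ≡ 2 * (p * e)
      rearrange₂ = solve-∀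
      rearrange₃ : ∀ k u → 2 * (8 * (k * u)) ≡ k * (16 * u)
      rearrange₃ = solve-∀
      counted : k * 2 ^ n * E ≤ 8 * (k * U)
      counted = begin
        k * 2 ^ n * E
          ≡⟨ sumEdges-*ˡ k (k * 2 ^ n) (λ _ _ → 1) ⟨
        sumEdges k (λ _ _ → k * 2 ^ n * 1)
          ≤⟨ sumEdges-mono k (λ x i → ≤-trans (≤-reflexive (*-identityʳ _)) (lowerHalf-isoperimetry n k 1≤k 128k²≤n (fiberDiff x i))) ⟩
        sumEdges k (λ x i → 8 * (k * distance (fiberDiff x i) lowerHalf + boundary (fiberDiff x i)))
          ≡⟨ trans (sumEdges-*ˡ k 8 _) (cong (8 *_) (trans (sumEdges-+ k _ _) (cong (_+ FibBd) (sumEdges-*ˡ k k _)))) ⟩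
        8 * (k * Fib + FibBd)
          ≤⟨ *-monoʳ-≤ 8 (+-monoʳ-≤ (k * Fib) fiber-boundaries) ⟩
        8 * (k * Fib + k * Cross)
          ≡⟨ cong (8 *_) (trans (sym (*-distribˡ-+ k Fib Cross)) (cong (k *_) (sym unsatCount-Δ))) ⟩
        8 * (k * U)
          ∎

  unsatCount-Δ-lower : ∀ d k → 1 ≤ k → 144 * (k * k) ≤ d → (σ : Assignment d) →
    k * length (allEdges d) ≤ 8 * unsatCount (Δ k d) σ * d
  unsatCount-Δ-lower d k 1≤k 144k²≤d = split (d ∸ k) (m+[n∸m]≡n k≤d) 128k²≤d∸k
    where
    k≤k² : k ≤ k * k
    k≤k² = ≤-trans (≤-reflexive (sym (*-identityʳ k))) (*-monoʳ-≤ k 1≤k)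
    k≤d : k ≤ d
    k≤d = ≤-trans k≤k² (≤-trans (m≤n*m (k * k) 144) 144k²≤d)
    128k²≤d∸k : 128 * (k * k) ≤ d ∸ k
    128k²≤d∸k = m+n≤o⇒m≤o∸n (128 * (k * k))
      (≤-trans (+-monoʳ-≤ (128 * (k * k)) (≤-trans k≤k² (m≤n*m (k * k) 16)))
               (≤-trans (≤-reflexive (sym (*-distribʳ-+ (k * k) 128 16))) 144k²≤d))
    split : ∀ n → k + n ≡ d → 128 * (k * k) ≤ n → (σ : Assignment d) → k * length (allEdges d) ≤ 8 * unsatCount (Δ k d) σ * d
    split n refl 128k²≤n σ = *-cancelˡ-≤ 2 (begin
      2 * (k * E)                ≡⟨ rearrange₁ k E ⟩
      k * (2 * E)                ≡⟨ cong (k *_) (length-allEdges (k + n)) ⟩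
      k * ((k + n) * 2 ^ (k + n)) ≡⟨ rearrange₂ k (k + n) (2 ^ (k + n)) ⟩
      (k + n) * (k * 2 ^ (k + n)) ≤⟨ *-monoʳ-≤ (k + n) (unsatCount-Δ-bound k n σ 1≤k 128k²≤n) ⟩
      (k + n) * (16 * U)         ≡⟨ rearrange₃ (k + n) U ⟩
      2 * (8 * U * (k + n))      ∎)
      where
      open ≤-Reasoning
      E = length (allEdges (k + n))
      U = unsatCount (Δ k (k + n)) σ
      rearrange₁ : ∀ k e → 2 * (k * e) ≡ k * (2 * e)
      rearrange₁ = solve-∀
      rearrange₂ : ∀ k d p → k * (d * p) ≡ d * (k * p)
      rearrange₂ = solve-∀
      rearrange₃ : ∀ d u → d * (16 * u) ≡ 2 * (8 * u * d)
      rearrange₃ = solve-∀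

open import Data.Integer as ℤ using (+_)
import Data.Integer.Properties as ℤ
open import Data.List using (length)
open import Data.Nat using (ℕ; _≤_)
import Data.Nat as ℕ
import Data.Nat.Properties as ℕ
open import Data.Nat.Coprimality using (1-coprimeTo) renaming (sym to coprime-sym)
open import Data.Product using (Σ; _×_; _,_)
open import Data.Rational using (ℚ; 0ℚ; _<_; _*_) renaming (_≤_ to _≤ℚ_)
import Data.Rational as ℚ
import Data.Rational.Properties as ℚ
open import Relation.Binary.PropositionalEquality using (_≡_; sym; trans; cong; subst₂)

open HypercubeCounting using (unsatCount-Δ-lower)

ℕ→ℚ-mkℚ : ∀ a → ℕ→ℚ a ≡ ℚ.mkℚ (+ a) 0 (coprime-sym (1-coprimeTo a))
ℕ→ℚ-mkℚ a = ℚ.↥p/↧p≡p (ℚ.mkℚ (+ a) 0 (coprime-sym (1-coprimeTo a)))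

ℕ→ℚ-* : ∀ a b → ℕ→ℚ a * ℕ→ℚ b ≡ ℕ→ℚ (a ℕ.* b)
ℕ→ℚ-* a b rewrite ℕ→ℚ-mkℚ a | ℕ→ℚ-mkℚ b = cong (ℚ._/ 1) (ℤ.+◃n≡+n (a ℕ.* b))

ℕ→ℚ-mono-≤ : ∀ {a b} → a ≤ b → ℕ→ℚ a ≤ℚ ℕ→ℚ b
ℕ→ℚ-mono-≤ {a} {b} a≤b rewrite ℕ→ℚ-mkℚ a | ℕ→ℚ-mkℚ b =
  ℚ.*≤* (subst₂ ℤ._≤_ (sym (ℤ.*-identityʳ (+ a))) (sym (ℤ.*-identityʳ (+ b))) (ℤ.+≤+ a≤b))

ℕ→ℚ-cancel-≤ : ∀ {a b} → ℕ→ℚ a ≤ℚ ℕ→ℚ b → a ≤ b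
ℕ→ℚ-cancel-≤ {a} {b} a≤b rewrite ℕ→ℚ-mkℚ a | ℕ→ℚ-mkℚ b
  with subst₂ ℤ._≤_ (ℤ.*-identityʳ (+ a)) (ℤ.*-identityʳ (+ b)) (ℚ.drop-*≤* a≤b)
... | ℤ.+≤+ a≤b′ = a≤b′

ℕ→ℚ-square-bound : ∀ k d → ℕ→ℚ k * ℕ→ℚ k ≤ℚ (+ 1 ℚ./ 12) * (+ 1 ℚ./ 12) * ℕ→ℚ d → 144 ℕ.* (k ℕ.* k) ≤ d
ℕ→ℚ-square-bound k d k²≤d/144 = ℕ→ℚ-cancel-≤ (begin
  ℕ→ℚ (144 ℕ.* (k ℕ.* k))                     ≡⟨ sym (trans (cong (ℕ→ℚ 144 *_) (ℕ→ℚ-* k k)) (ℕ→ℚ-* 144 (k ℕ.* k))) ⟩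
  ℕ→ℚ 144 * (ℕ→ℚ k * ℕ→ℚ k)                   ≤⟨ ℚ.*-monoˡ-≤-nonNeg (ℕ→ℚ 144) k²≤d/144 ⟩
  ℕ→ℚ 144 * (c * c * ℕ→ℚ d)                   ≡⟨ sym (ℚ.*-assoc (ℕ→ℚ 144) (c * c) (ℕ→ℚ d)) ⟩
  ℕ→ℚ 144 * (c * c) * ℕ→ℚ d                   ≡⟨ ℚ.*-identityˡ (ℕ→ℚ d) ⟩
  ℕ→ℚ d                                       ∎)
  where
  open ℚ.≤-Reasoning
  c = + 1 ℚ./ 12

ℕ→ℚ-eighth-bound : ∀ k e u d → k ℕ.* e ≤ 8 ℕ.* u ℕ.* d → (+ 1 ℚ./ 8) * ℕ→ℚ k * ℕ→ℚ e ≤ℚ ℕ→ℚ u * ℕ→ℚ d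
ℕ→ℚ-eighth-bound k e u d ke≤8ud = begin
  c * ℕ→ℚ k * ℕ→ℚ e               ≡⟨ trans (ℚ.*-assoc c (ℕ→ℚ k) (ℕ→ℚ e)) (cong (c *_) (ℕ→ℚ-* k e)) ⟩
  c * ℕ→ℚ (k ℕ.* e)               ≤⟨ ℚ.*-monoˡ-≤-nonNeg c (ℕ→ℚ-mono-≤ ke≤8ud) ⟩
  c * ℕ→ℚ (8 ℕ.* u ℕ.* d)         ≡⟨ cong (c *_) (trans (cong ℕ→ℚ (ℕ.*-assoc 8 u d)) (sym (ℕ→ℚ-* 8 (u ℕ.* d)))) ⟩
  c * (ℕ→ℚ 8 * ℕ→ℚ (u ℕ.* d))     ≡⟨ sym (ℚ.*-assoc c (ℕ→ℚ 8) (ℕ→ℚ (u ℕ.* d))) ⟩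
  c * ℕ→ℚ 8 * ℕ→ℚ (u ℕ.* d)       ≡⟨ ℚ.*-identityˡ (ℕ→ℚ (u ℕ.* d)) ⟩
  ℕ→ℚ (u ℕ.* d)                   ≡⟨ sym (ℕ→ℚ-* u d) ⟩
  ℕ→ℚ u * ℕ→ℚ d                   ∎
  where
  open ℚ.≤-Reasoning
  c = + 1 ℚ./ 8

lemma3p5 : Σ ℚ λ c₁ → Σ ℚ λ c₂ → (0ℚ < c₁) × (0ℚ < c₂) ×
    ((d k : ℕ) → 1 ≤ k → ℕ→ℚ k * ℕ→ℚ k ≤ℚ c₁ * c₁ * ℕ→ℚ d →
      (σ : Assignment d) →
      c₂ * ℕ→ℚ k * ℕ→ℚ (length (allEdges d)) ≤ℚ ℕ→ℚ (unsatCount (Δ k d) σ) * ℕ→ℚ d)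
lemma3p5 = + 1 ℚ./ 12 , + 1 ℚ./ 8 , ℚ.*<* (ℤ.+<+ (ℕ.s≤s ℕ.z≤n)) , ℚ.*<* (ℤ.+<+ (ℕ.s≤s ℕ.z≤n)) ,
  λ d k 1≤k k²≤d/144 σ → ℕ→ℚ-eighth-bound k (length (allEdges d)) (unsatCount (Δ k d) σ) d
                           (unsatCount-Δ-lower d k 1≤k (ℕ→ℚ-square-bound k d k²≤d/144) σ)
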